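{- Let $p,q\in\mathbb{Z}$ with $q>1$, let $F(x,y)=\min(px+qy,0)$, and let $n\in\mathbb{Z}_{>0}$ and $m\in\mathbb{Z}$. Let $A=([0,q-1]\times[m,m+|p|+|q|])\cap\mathbb{Z}^2$, and suppose $A\subset\{F\neq S_n(F)\}$. If the restriction of $S_n(F)$ to $A$ is linear (of the form $ax+by+c$), then $\gcd(p,q)>1$.
   Context: The discrete Laplacian is $\Delta F(x,y)=-4F(x,y)+F(x+1,y)+F(x-1,y)+F(x,y+1)+F(x,y-1)$. The function $F$ is superharmonic if $\Delta F\le0$. The deviation set is $D(F)=\{v:\Delta F(v)\ne0\}$. $B_C(A)$ is the set of points at distance at most $C$ from $A$. $\Theta_n(F)$ is the set of all $G:\mathbb{Z}^2\to\mathbb{Z}$ such that: - $\Delta G\le0$; - $F-n\le G\le F$; - $\{F\ne G\}\subset B_C(D(F))$ for some $C>0$. $S_n(F)(v)=\min\{G(v):G\in\Theta_n(F)\}$. -}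

module Defs where

open import Data.Integer using (ℤ; +_; _+_; _-_; _*_; _≤_; _⊓_; 0ℤ; 1ℤ; ∣_∣)
open import Data.Nat using (ℕ; _>_)
open import Data.Product using (Σ; ∃; _×_)
open import Relation.Binary.PropositionalEquality using (_≡_; _≢_)

Fun : Set
Fun = ℤ → ℤ → ℤ

Δ : Fun → ℤ → ℤ → ℤ
Δ F x y = (F (x + 1ℤ) y + F (x - 1ℤ) y + F x (y + 1ℤ) + F x (y - 1ℤ)) - (+ 4) * F x y

Superharmonic : Fun → Set
Superharmonic G = ∀ x y → Δ G x y ≤ 0ℤ

dist² : ℤ → ℤ → ℤ → ℤ → ℤ
dist² x y x' y' = (x - x') * (x - x') + (y - y') * (y - y')

-- {F ≠ G} ⊂ B_C(D(F)) for some C > 0 (Euclidean distance; C may be taken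
-- natural without loss of generality, and dist ≤ C  ⇔  dist² ≤ C²).
DiffNearDeviation : Fun → Fun → Set
DiffNearDeviation F G =
  Σ ℕ λ C → (C > 0) ×
    (∀ x y → F x y ≢ G x y →
      Σ ℤ λ x' → Σ ℤ λ y' → (Δ F x' y' ≢ 0ℤ) × (dist² x y x' y' ≤ (+ C) * (+ C)))

InΘ : ℤ → Fun → Fun → Set
InΘ n F G =
  Superharmonic G ×
  (∀ x y → F x y - n ≤ G x y) ×
  (∀ x y → G x y ≤ F x y) ×
  DiffNearDeviation F G

IsS : ℤ → Fun → Fun → Set
IsS n F S = ∀ x y →
  (Σ Fun λ G → InΘ n F G × (G x y ≡ S x y)) ×
  (∀ G → InΘ n F G → S x y ≤ G x y)

Fpq : ℤ → ℤ → Fun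
Fpq p q x y = (p * x + q * y) ⊓ 0ℤ

InA : ℤ → ℤ → ℤ → ℤ → ℤ → Set
InA p q m x y =
  (0ℤ ≤ x) × (x ≤ q - 1ℤ) × (m ≤ y) × (y ≤ m + (+ ∣ p ∣) + (+ ∣ q ∣))

module Submission where

-- Suppose p and q are coprime.  (1) A decay lemma for bounded subharmonic
-- profiles on ℤ shows that every G ∈ Θ_n(F), hence S, equals F where |N| is
-- large.  (2) S is superharmonic and invariant under the period (q,-p) of F.
-- (3) For a periodic cut through the columns 0, …, q-1 we define its flux;
-- raising the cut adds the Laplacians of S along it, so the flux decreases
-- upwards, and where it stays constant S is harmonic along the cuts.
-- (4) Superharmonicity of the linear form across the period gives aq = bp,
-- so (a,b) = s(p,q), and the cut through A has flux s(q² + p²), while cuts far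
-- above and far below have fluxes 0 and q² + p²; hence s ∈ {0,1}.  In both
-- cases the flux is constant between A and the far cut, and zeros of S
-- (resp. of S - N) spread from far away into A, giving S = F at a point of A.

open import Data.Nat as ℕ using (ℕ; zero; suc)
import Data.Nat.Properties as NP
open import Data.Integer as Z
  using (ℤ; +_; -[1+_]; _+_; _-_; _*_; -_; _≤_; _<_; _>_; _⊓_; 0ℤ; 1ℤ; ∣_∣; +≤+; -≤+; -≤-; +<+)
import Data.Integer.Properties as ZP
open import Data.Integer.Tactic.RingSolver using (solve-∀)
open import Data.Product using (Σ; _×_; _,_; proj₁; proj₂)
open import Data.Sum using (_⊎_; inj₁; inj₂)
open import Data.Empty using (⊥; ⊥-elim)
open import Relation.Nullary using (¬_; yes; no; Dec)
open import Relation.Nullary.Decidable using (decidable-stable)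
open import Relation.Binary.PropositionalEquality
import Data.Nat.Divisibility as ND
import Data.Nat.GCD as NG
import Data.Nat.Coprimality as NC
open import Data.Integer.GCD using (gcd)
open import Function using (case_of_)
open import Defs

+-nonneg : ∀ {a b} → 0ℤ ≤ a → 0ℤ ≤ b → 0ℤ ≤ a + b
+-nonneg = ZP.+-mono-≤

*-nonneg : ∀ {a b} → 0ℤ ≤ a → 0ℤ ≤ b → 0ℤ ≤ a * b
*-nonneg {+ m} {+ k} _ _ = ZP.*-monoʳ-≤-nonNeg (+ k) {0ℤ} {+ m} (+≤+ ℕ.z≤n)

ℕ-nonneg : ∀ k → 0ℤ ≤ + k
ℕ-nonneg k = +≤+ ℕ.z≤n

≤-offset : ∀ {i j} k → 0ℤ ≤ k → j ≡ i + k → i ≤ j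
≤-offset {i} k 0≤k refl = subst (_≤ i + k) (ZP.+-identityʳ i) (ZP.+-monoʳ-≤ i 0≤k)

drop-nonpos : ∀ a {t} → t ≤ 0ℤ → a + t ≤ a
drop-nonpos a t≤0 = subst (a + _ ≤_) (ZP.+-identityʳ a) (ZP.+-monoʳ-≤ a t≤0)

j≤i+1∧j≢i+1⇒j≤i : ∀ {j i} → j ≤ i + 1ℤ → j ≢ i + 1ℤ → j ≤ i
j≤i+1∧j≢i+1⇒j≤i {j} {i} h ne = subst (j ≤_) (ZP.+-identityʳ i)
  (subst (λ z → j ≤ z) (lem i) (ZP.i<j⇒i≤pred[j] (ZP.≤∧≢⇒< h ne)))
  where
  lem : ∀ i → - 1ℤ + (i + 1ℤ) ≡ i + 0ℤ
  lem = solve-∀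

nonpos-sum≡0 : ∀ {a b} → a ≤ 0ℤ → b ≤ 0ℤ → a + b ≡ 0ℤ → (a ≡ 0ℤ) × (b ≡ 0ℤ)
nonpos-sum≡0 {a} {b} a≤0 b≤0 e =
  ZP.≤-antisym a≤0 (subst₂ _≤_ e (ZP.+-identityʳ a) (ZP.+-monoʳ-≤ a b≤0)) ,
  ZP.≤-antisym b≤0 (subst₂ _≤_ e (ZP.+-identityˡ b) (ZP.+-monoˡ-≤ b a≤0))

nonneg-sum≡0 : ∀ {a b} → 0ℤ ≤ a → 0ℤ ≤ b → a + b ≡ 0ℤ → (a ≡ 0ℤ) × (b ≡ 0ℤ)
nonneg-sum≡0 {a} {b} 0≤a 0≤b e =
  ZP.≤-antisym (subst₂ _≤_ (ZP.+-identityʳ a) e (ZP.+-monoʳ-≤ a 0≤b)) 0≤a ,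
  ZP.≤-antisym (subst₂ _≤_ (ZP.+-identityˡ b) e (ZP.+-monoˡ-≤ b 0≤a)) 0≤b

i≤∣i∣ : ∀ i → i ≤ + ∣ i ∣
i≤∣i∣ (+ k) = ZP.≤-refl
i≤∣i∣ -[1+ k ] = -≤+

-i≤∣i∣ : ∀ i → - i ≤ + ∣ i ∣
-i≤∣i∣ i = subst (λ z → - i ≤ + z) (ZP.∣-i∣≡∣i∣ i) (i≤∣i∣ (- i))

-- Walking |j - i| steps up from i reaches j (exactly, when i ≤ j); this turns
-- integer intervals into natural-number step counts for induction.
j≤i+∣j-i∣ : ∀ i j → j ≤ i + + ∣ j - i ∣
j≤i+∣j-i∣ i j = ≤-offset (+ ∣ j - i ∣ - (j - i)) (ZP.i≤j⇒0≤j-i (i≤∣i∣ (j - i))) (lem i j (+ ∣ j - i ∣))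
  where
  lem : ∀ i j a → i + a ≡ j + (a - (j - i))
  lem = solve-∀

i+∣j-i∣≡j : ∀ {i j} → i ≤ j → i + + ∣ j - i ∣ ≡ j
i+∣j-i∣≡j {i} {j} i≤j =
  trans (cong (λ z → i + z) (trans (cong +_ (ZP.∣i-j∣≡∣j-i∣ j i)) (ZP.∣-∣-≤ i≤j))) (lem i j)
  where
  lem : ∀ i j → i + (j - i) ≡ j
  lem = solve-∀

k≤∣j∣⇒±k : ∀ j k → k ℕ.≤ ∣ j ∣ → (+ k ≤ j) ⊎ (j ≤ - + k)
k≤∣j∣⇒±k (+ m) k h = inj₁ (+≤+ h)
k≤∣j∣⇒±k -[1+ m ] zero h = inj₂ -≤+
k≤∣j∣⇒±k -[1+ m ] (suc k) h = inj₂ (-≤- (NP.≤-pred h))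

k≤j⇒k≤∣j∣ : ∀ j k → + k ≤ j → k ℕ.≤ ∣ j ∣
k≤j⇒k≤∣j∣ (+ m) k (+≤+ h) = h

j≤-k⇒k≤∣j∣ : ∀ j k → j ≤ - + k → k ℕ.≤ ∣ j ∣
j≤-k⇒k≤∣j∣ (+ m) zero h = ℕ.z≤n
j≤-k⇒k≤∣j∣ -[1+ m ] zero h = ℕ.z≤n
j≤-k⇒k≤∣j∣ -[1+ m ] (suc k) (-≤- h) = ℕ.s≤s h

i*i≡∣i∣² : ∀ i → i * i ≡ + (∣ i ∣ ℕ.* ∣ i ∣)
i*i≡∣i∣² (+ k) = sym (ZP.pos-* k k)
i*i≡∣i∣² -[1+ k ] = refl

a²≤c²⇒a≤c : ∀ a c → a ℕ.* a ℕ.≤ c ℕ.* c → a ℕ.≤ c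
a²≤c²⇒a≤c a c h with a ℕ.≤? c
... | yes a≤c = a≤c
... | no a≰c = ⊥-elim (NP.<⇒≱ (NP.*-mono-< (NP.≰⇒> a≰c) (NP.≰⇒> a≰c)) h)

coordinate-bound : ∀ dx dy C → dx * dx + dy * dy ≤ + C * + C → (∣ dx ∣ ℕ.≤ C) × (∣ dy ∣ ℕ.≤ C)
coordinate-bound dx dy C h =
  a²≤c²⇒a≤c _ _ (ZP.drop‿+≤+ (ZP.≤-trans (ZP.i≤i+j (+ (∣ dx ∣ ℕ.* ∣ dx ∣)) (+ (∣ dy ∣ ℕ.* ∣ dy ∣))) h²)) ,
  a²≤c²⇒a≤c _ _ (ZP.drop‿+≤+ (ZP.≤-trans (ZP.i≤j+i (+ (∣ dy ∣ ℕ.* ∣ dy ∣)) (+ (∣ dx ∣ ℕ.* ∣ dx ∣))) h²))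
  where
  h² : + (∣ dx ∣ ℕ.* ∣ dx ∣) + + (∣ dy ∣ ℕ.* ∣ dy ∣) ≤ + (C ℕ.* C)
  h² = subst₂ _≤_ (cong₂ _+_ (i*i≡∣i∣² dx) (i*i≡∣i∣² dy)) (sym (ZP.pos-* C C)) h

sum : ℕ → (ℕ → ℤ) → ℤ
sum zero g = 0ℤ
sum (suc n) g = sum n g + g n

sum-cong : ∀ n {g h : ℕ → ℤ} → (∀ i → i ℕ.< n → g i ≡ h i) → sum n g ≡ sum n h
sum-cong zero e = refl
sum-cong (suc n) e = cong₂ _+_ (sum-cong n (λ i lt → e i (NP.m<n⇒m<1+n lt))) (e n NP.≤-refl)

sum-+ : ∀ n (g h : ℕ → ℤ) → sum n (λ i → g i + h i) ≡ sum n g + sum n h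
sum-+ zero g h = refl
sum-+ (suc n) g h = trans (cong (_+ (g n + h n)) (sum-+ n g h)) (lem (sum n g) (sum n h) (g n) (h n))
  where
  lem : ∀ a b c d → a + b + (c + d) ≡ a + c + (b + d)
  lem = solve-∀

sum-neg : ∀ n (g : ℕ → ℤ) → sum n (λ i → - g i) ≡ - sum n g
sum-neg zero g = refl
sum-neg (suc n) g = trans (cong (_+ (- g n)) (sum-neg n g)) (sym (ZP.neg-distrib-+ (sum n g) (g n)))

sum-- : ∀ n (g h : ℕ → ℤ) → sum n (λ i → g i - h i) ≡ sum n g - sum n h
sum-- n g h = trans (sum-+ n g (λ i → - h i)) (cong (λ z → sum n g + z) (sum-neg n h))

sum-scale : ∀ n c (g : ℕ → ℤ) → sum n (λ i → c * g i) ≡ c * sum n g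
sum-scale zero c g = sym (ZP.*-zeroʳ c)
sum-scale (suc n) c g =
  trans (cong (_+ (c * g n)) (sum-scale n c g)) (sym (ZP.*-distribˡ-+ c (sum n g) (g n)))

sum-const : ∀ n c → sum n (λ _ → c) ≡ + n * c
sum-const zero c = refl
sum-const (suc n) c = trans (cong (_+ c) (sum-const n c)) (lem (+ n) c)
  where
  lem : ∀ a c → a * c + c ≡ (1ℤ + a) * c
  lem = solve-∀

sum-zero : ∀ n (g : ℕ → ℤ) → (∀ i → i ℕ.< n → g i ≡ 0ℤ) → sum n g ≡ 0ℤ
sum-zero n g h = trans (sum-cong n h) (trans (sum-const n 0ℤ) (ZP.*-zeroʳ (+ n)))

sum-suc : ∀ n (g : ℕ → ℤ) → sum (suc n) g ≡ g 0 + sum n (λ i → g (suc i))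
sum-suc zero g = ZP.+-comm 0ℤ (g 0)
sum-suc (suc n) g = trans (cong (_+ g (suc n)) (sum-suc n g)) (ZP.+-assoc (g 0) _ _)

sum-mono : ∀ n {g h : ℕ → ℤ} → (∀ i → i ℕ.< n → g i ≤ h i) → sum n g ≤ sum n h
sum-mono zero e = ZP.≤-refl
sum-mono (suc n) e = ZP.+-mono-≤ (sum-mono n (λ i lt → e i (NP.m<n⇒m<1+n lt))) (e n NP.≤-refl)

sum-nonneg : ∀ n {g : ℕ → ℤ} → (∀ i → i ℕ.< n → 0ℤ ≤ g i) → 0ℤ ≤ sum n g
sum-nonneg n {g} e = subst (_≤ sum n g) (sum-zero n (λ _ → 0ℤ) (λ _ _ → refl)) (sum-mono n e)

sum-nonpos : ∀ n {g : ℕ → ℤ} → (∀ i → i ℕ.< n → g i ≤ 0ℤ) → sum n g ≤ 0ℤ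
sum-nonpos n {g} e = subst (sum n g ≤_) (sum-zero n (λ _ → 0ℤ) (λ _ _ → refl)) (sum-mono n e)

sum-≤-const : ∀ n c {g : ℕ → ℤ} → (∀ i → i ℕ.< n → g i ≤ c) → sum n g ≤ + n * c
sum-≤-const n c {g} e = subst (sum n g ≤_) (sum-const n c) (sum-mono n e)

sum-nonpos≡0 : ∀ n (g : ℕ → ℤ) → (∀ i → i ℕ.< n → g i ≤ 0ℤ) → sum n g ≡ 0ℤ →
  ∀ i → i ℕ.< n → g i ≡ 0ℤ
sum-nonpos≡0 (suc n) g g≤0 e i i<1+n
  with nonpos-sum≡0 (sum-nonpos n (λ k k<n → g≤0 k (NP.m<n⇒m<1+n k<n))) (g≤0 n NP.≤-refl) e
... | init≡0 , last≡0 with i ℕ.≟ n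
... | yes refl = last≡0
... | no i≢n = sum-nonpos≡0 n g (λ k k<n → g≤0 k (NP.m<n⇒m<1+n k<n)) init≡0 i
                 (NP.≤∧≢⇒< (NP.≤-pred i<1+n) i≢n)

window-shift : ∀ s (f : ℤ → ℤ) T →
  sum s (λ i → f ((T + 1ℤ) + + i)) ≡ sum s (λ i → f (T + + i)) + f (T + + s) - f T
window-shift s f T = trans (lem (sum s (λ i → f ((T + 1ℤ) + + i))) (f T)) (cong (_- f T) (sym unrolled))
  where
  lem : ∀ a b → a ≡ b + a - b
  lem = solve-∀
  unrolled : sum s (λ i → f (T + + i)) + f (T + + s) ≡ f T + sum s (λ i → f ((T + 1ℤ) + + i))
  unrolled = trans (sum-suc s (λ i → f (T + + i)))
    (cong₂ _+_ (cong f (ZP.+-identityʳ T)) (sum-cong s (λ i _ → cong f (sym (ZP.+-assoc T 1ℤ (+ i))))))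

-- The one-dimensional decay lemma.

Lap : ℕ → ℕ → (ℤ → ℤ) → ℤ → ℤ
Lap s₁ s₂ μ j = μ (j + + s₁) + μ (j - + s₁) + μ (j + + s₂) + μ (j - + s₂) - + 4 * μ j

-- Bound on the potential used in the decay lemma; a subharmonic profile with
-- values in [0,n] has died out this far beyond the start of subharmonicity.
decayLength : ℕ → ℕ → ℤ → ℤ
decayLength s₁ s₂ n = + s₁ * (+ s₁ * n) + + s₂ * (+ s₂ * n)

-- Proof of the decay lemma for μ with values in [0,n], Lap μ ≥ 0 on [M₀,∞) and
-- μ = 0 on [C,∞).  Window sums of μ give a flux whose increments are Lap μ, and
-- window sums of windows give a bounded potential whose increments are the
-- flux.  The flux is nondecreasing and eventually 0, hence ≤ 0; a bounded
-- potential forbids it to stay negative for long, so it vanishes beyond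
-- M₀ + decayLength, and so does Lap μ; harmonicity then propagates the zeros
-- of μ downwards from C in steps of s₂.
module DecayProof (s₁ s₂ : ℕ) (s₂≥1 : 1 ℕ.≤ s₂) (μ : ℤ → ℤ) (n M₀ C : ℤ)
  (bounded : ∀ j → (0ℤ ≤ μ j) × (μ j ≤ n))
  (subharmonic : ∀ j → M₀ ≤ j → 0ℤ ≤ Lap s₁ s₂ μ j)
  (vanishing : ∀ j → C ≤ j → μ j ≡ 0ℤ) where

  window : ℕ → ℤ → ℤ
  window s T = sum s (λ i → μ (T + + i))

  flux : ℕ → ℤ → ℤ
  flux s T = window s T - window s (T - + s)

  Flux : ℤ → ℤ
  Flux T = flux s₁ T + flux s₂ T

  potential : ℕ → ℤ → ℤ
  potential s T = sum s (λ i → window s (T - + s + + i))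

  Potential : ℤ → ℤ
  Potential T = potential s₁ T + potential s₂ T

  +1-s : ∀ T s → T + 1ℤ - s ≡ (T - s) + 1ℤ
  +1-s = solve-∀
  -s+s : ∀ T s → T - s + s ≡ T
  -s+s = solve-∀

  flux-step : ∀ s T → flux s (T + 1ℤ) ≡ flux s T + (μ (T + + s) + μ (T - + s) - + 2 * μ T)
  flux-step s T = begin
      window s (T + 1ℤ) - window s (T + 1ℤ - + s)
    ≡⟨ cong₂ _-_ (window-shift s μ T)
                 (trans (cong (window s) (+1-s T (+ s))) (window-shift s μ (T - + s))) ⟩
      (window s T + μ (T + + s) - μ T) - (window s (T - + s) + μ (T - + s + + s) - μ (T - + s))
    ≡⟨ cong (λ z → (window s T + μ (T + + s) - μ T) - (window s (T - + s) + μ z - μ (T - + s)))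
            (-s+s T (+ s)) ⟩
      (window s T + μ (T + + s) - μ T) - (window s (T - + s) + μ T - μ (T - + s))
    ≡⟨ lem (window s T) (window s (T - + s)) (μ (T + + s)) (μ T) (μ (T - + s)) ⟩
      flux s T + (μ (T + + s) + μ (T - + s) - + 2 * μ T) ∎
    where
    open ≡-Reasoning
    lem : ∀ a b x y z → (a + x - y) - (b + y - z) ≡ (a - b) + (x + z - + 2 * y)
    lem = solve-∀

  Flux-step : ∀ T → Flux (T + 1ℤ) ≡ Flux T + Lap s₁ s₂ μ T
  Flux-step T = trans (cong₂ _+_ (flux-step s₁ T) (flux-step s₂ T))
    (lem (flux s₁ T) (flux s₂ T) (μ (T + + s₁)) (μ (T - + s₁)) (μ (T + + s₂)) (μ (T - + s₂)) (μ T))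
    where
    lem : ∀ a b x₁ y₁ x₂ y₂ z → (a + (x₁ + y₁ - + 2 * z)) + (b + (x₂ + y₂ - + 2 * z))
                              ≡ (a + b) + (x₁ + y₁ + x₂ + y₂ - + 4 * z)
    lem = solve-∀

  potential-step : ∀ s T → potential s (T + 1ℤ) ≡ potential s T + flux s T
  potential-step s T = begin
      sum s (λ i → window s (T + 1ℤ - + s + + i))
    ≡⟨ sum-cong s (λ i _ → cong (λ z → window s (z + + i)) (+1-s T (+ s))) ⟩
      sum s (λ i → window s ((T - + s) + 1ℤ + + i))
    ≡⟨ window-shift s (window s) (T - + s) ⟩
      potential s T + window s (T - + s + + s) - window s (T - + s)
    ≡⟨ cong (λ z → potential s T + window s z - window s (T - + s)) (-s+s T (+ s)) ⟩
      potential s T + window s T - window s (T - + s)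
    ≡⟨ ZP.+-assoc (potential s T) (window s T) (- window s (T - + s)) ⟩
      potential s T + flux s T ∎
    where open ≡-Reasoning

  Potential-step : ∀ T → Potential (T + 1ℤ) ≡ Potential T + Flux T
  Potential-step T = trans (cong₂ _+_ (potential-step s₁ T) (potential-step s₂ T))
    (lem (potential s₁ T) (potential s₂ T) (flux s₁ T) (flux s₂ T))
    where
    lem : ∀ a b c d → a + c + (b + d) ≡ a + b + (c + d)
    lem = solve-∀

  window-bounds : ∀ s T → (0ℤ ≤ window s T) × (window s T ≤ + s * n)
  window-bounds s T = sum-nonneg s (λ i _ → proj₁ (bounded _)) , sum-≤-const s n (λ i _ → proj₂ (bounded _))

  Potential-nonneg : ∀ T → 0ℤ ≤ Potential T
  Potential-nonneg T =
    +-nonneg (sum-nonneg s₁ (λ i _ → proj₁ (window-bounds s₁ (T - + s₁ + + i))))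
             (sum-nonneg s₂ (λ i _ → proj₁ (window-bounds s₂ (T - + s₂ + + i))))

  Potential-bounded : ∀ T → Potential T ≤ decayLength s₁ s₂ n
  Potential-bounded T =
    ZP.+-mono-≤ (sum-≤-const s₁ _ (λ i _ → proj₂ (window-bounds s₁ (T - + s₁ + + i))))
                (sum-≤-const s₂ _ (λ i _ → proj₂ (window-bounds s₂ (T - + s₂ + + i))))

  n≥0 : 0ℤ ≤ n
  n≥0 = ZP.≤-trans (proj₁ (bounded 0ℤ)) (proj₂ (bounded 0ℤ))

  +d+1 : ∀ T d → T + + d + 1ℤ ≡ T + + suc d
  +d+1 T d = trans (ZP.+-assoc T (+ d) 1ℤ) (cong (λ z → T + + z) (NP.+-comm d 1))

  Flux-mono-steps : ∀ T → M₀ ≤ T → ∀ d → Flux T ≤ Flux (T + + d)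
  Flux-mono-steps T M₀≤T zero = subst (λ z → Flux T ≤ Flux z) (sym (ZP.+-identityʳ T)) ZP.≤-refl
  Flux-mono-steps T M₀≤T (suc d) = ZP.≤-trans (Flux-mono-steps T M₀≤T d)
    (subst (λ z → Flux (T + + d) ≤ Flux z) (+d+1 T d)
      (subst (Flux (T + + d) ≤_) (sym (Flux-step (T + + d)))
        (≤-offset _ (subharmonic _ (ZP.≤-trans M₀≤T (ZP.i≤i+j T (+ d)))) refl)))

  Flux-mono : ∀ T T' → M₀ ≤ T → T ≤ T' → Flux T ≤ Flux T'
  Flux-mono T T' M₀≤T T≤T' = subst (λ z → Flux T ≤ Flux z) (i+∣j-i∣≡j T≤T') (Flux-mono-steps T M₀≤T _)

  flux-far : ∀ s T → C + + s ≤ T → flux s T ≡ 0ℤ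
  flux-far s T h = cong₂ _-_ (window≡0 T (ZP.≤-trans (ZP.i≤i+j C (+ s)) h))
                             (window≡0 (T - + s) (≤-offset (T - (C + + s)) (ZP.i≤j⇒0≤j-i h) (lem T C (+ s))))
    where
    lem : ∀ T c s → T - s ≡ c + (T - (c + s))
    lem = solve-∀
    window≡0 : ∀ T → C ≤ T → window s T ≡ 0ℤ
    window≡0 T C≤T = sum-zero s _ (λ i _ → vanishing _ (ZP.≤-trans C≤T (ZP.i≤i+j T (+ i))))

  Flux-far : ∀ T → C + + s₁ + + s₂ ≤ T → Flux T ≡ 0ℤ
  Flux-far T h = cong₂ _+_ (flux-far s₁ T (ZP.≤-trans (ZP.i≤i+j (C + + s₁) (+ s₂)) h))
                           (flux-far s₂ T (ZP.≤-trans (≤-offset (+ s₁) (ℕ-nonneg s₁) (lem C (+ s₁) (+ s₂))) h))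
    where
    lem : ∀ c a b → c + a + b ≡ c + b + a
    lem = solve-∀

  -- Nondecreasing and eventually zero: the flux is ≤ 0 on [M₀,∞).
  Flux-nonpos : ∀ T → M₀ ≤ T → Flux T ≤ 0ℤ
  Flux-nonpos T M₀≤T = subst (Flux T ≤_) (Flux-far _ (j≤i+∣j-i∣ T (C + + s₁ + + s₂))) (Flux-mono-steps T M₀≤T _)

  T* : ℤ
  T* = M₀ + decayLength s₁ s₂ n

  B : ℕ
  B = ∣ decayLength s₁ s₂ n ∣

  +B≡decayLength : + B ≡ decayLength s₁ s₂ n
  +B≡decayLength = ZP.0≤i⇒+∣i∣≡i
    (+-nonneg (*-nonneg (ℕ-nonneg s₁) (*-nonneg (ℕ-nonneg s₁) n≥0))
              (*-nonneg (ℕ-nonneg s₂) (*-nonneg (ℕ-nonneg s₂) n≥0)))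

  -- If the flux were negative at T*, it would be ≤ -1 on [M₀,T*] and the
  -- potential would drop by at least one per step there.
  Potential-drop : Flux T* < 0ℤ → ∀ k → k ℕ.≤ suc B → Potential (M₀ + + k) ≤ Potential M₀ - + k
  Potential-drop neg zero _ =
    subst₂ (λ a b → Potential a ≤ b) (sym (ZP.+-identityʳ M₀)) (sym (ZP.+-identityʳ (Potential M₀))) ZP.≤-refl
  Potential-drop neg (suc k) k<1+B =
    subst (λ z → Potential z ≤ Potential M₀ - + suc k) (+d+1 M₀ k)
      (subst (_≤ Potential M₀ - + suc k) (sym (Potential-step (M₀ + + k)))
        (subst (Potential (M₀ + + k) + Flux (M₀ + + k) ≤_) (lem (Potential M₀) (+ k))
          (ZP.+-mono-≤ (Potential-drop neg k (NP.<⇒≤ k<1+B)) Flux≤-1)))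
    where
    lem : ∀ v k → v - k + - 1ℤ ≡ v - (1ℤ + k)
    lem = solve-∀
    k≤B : M₀ + + k ≤ T*
    k≤B = subst (λ z → M₀ + + k ≤ M₀ + z) +B≡decayLength (ZP.+-monoʳ-≤ M₀ (+≤+ (NP.≤-pred k<1+B)))
    Flux≤-1 : Flux (M₀ + + k) ≤ - 1ℤ
    Flux≤-1 = ZP.≤-trans (Flux-mono _ _ (ZP.i≤i+j M₀ (+ k)) k≤B) (ZP.i<j⇒i≤pred[j] neg)

  Flux-T*-nonneg : 0ℤ ≤ Flux T*
  Flux-T*-nonneg with 0ℤ ZP.≤? Flux T*
  ... | yes h = h
  ... | no h = ⊥-elim (ZP.<-irrefl refl (ZP.≤-<-trans (Potential-nonneg (M₀ + + suc B)) too-small))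
    where
    lem : ∀ b → b - (1ℤ + b) ≡ - 1ℤ
    lem = solve-∀
    too-small : Potential (M₀ + + suc B) < 0ℤ
    too-small = ZP.≤-<-trans
      (ZP.≤-trans (subst (λ z → Potential (M₀ + + suc B) ≤ Potential M₀ - (1ℤ + z)) +B≡decayLength
                    (Potential-drop (ZP.≰⇒> h) (suc B) NP.≤-refl))
                  (ZP.+-monoˡ-≤ (- (1ℤ + decayLength s₁ s₂ n)) (Potential-bounded M₀)))
      (subst (_< 0ℤ) (sym (lem (decayLength s₁ s₂ n))) (ZP.suc[i]≤j⇒i<j ZP.≤-refl))

  M₀≤T* : M₀ ≤ T*
  M₀≤T* = ≤-offset _ (subst (0ℤ ≤_) +B≡decayLength (ℕ-nonneg B)) refl

  harmonic : ∀ T → T* ≤ T → Lap s₁ s₂ μ T ≡ 0ℤ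
  harmonic T T*≤T = begin
      Lap s₁ s₂ μ T             ≡⟨ sym (ZP.+-identityˡ _) ⟩
      0ℤ + Lap s₁ s₂ μ T        ≡⟨ cong (_+ Lap s₁ s₂ μ T) (sym (Flux≡0 T T*≤T)) ⟩
      Flux T + Lap s₁ s₂ μ T    ≡⟨ sym (Flux-step T) ⟩
      Flux (T + 1ℤ)             ≡⟨ Flux≡0 (T + 1ℤ) (ZP.≤-trans T*≤T (ZP.i≤i+j T 1ℤ)) ⟩
      0ℤ                        ∎
    where
    open ≡-Reasoning
    Flux≡0 : ∀ T → T* ≤ T → Flux T ≡ 0ℤ
    Flux≡0 T T*≤T = ZP.≤-antisym (Flux-nonpos T (ZP.≤-trans M₀≤T* T*≤T))
                                 (ZP.≤-trans Flux-T*-nonneg (Flux-mono T* T M₀≤T* T*≤T))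

  -- A zero of the nonnegative μ where μ is harmonic forces zeros at all four
  -- neighbours, in particular at T - s₂.
  zero-below : ∀ T → Lap s₁ s₂ μ T ≡ 0ℤ → μ T ≡ 0ℤ → μ (T - + s₂) ≡ 0ℤ
  zero-below T harm μT≡0 =
    proj₂ (nonneg-sum≡0 (+-nonneg (+-nonneg (proj₁ (bounded _)) (proj₁ (bounded _))) (proj₁ (bounded _)))
                        (proj₁ (bounded _))
                        (trans (sym (lem neighbours)) (trans (cong (λ z → neighbours - + 4 * z) (sym μT≡0)) harm)))
    where
    neighbours : ℤ
    neighbours = μ (T + + s₁) + μ (T - + s₁) + μ (T + + s₂) + μ (T - + s₂)
    lem : ∀ x → x - + 4 * 0ℤ ≡ x
    lem = solve-∀

  zero-from : ∀ d j → T* ≤ j → C - + d ≤ j → μ j ≡ 0ℤ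
  zero-from zero j _ h = vanishing j (subst (_≤ j) (ZP.+-identityʳ C) h)
  zero-from (suc d) j T*≤j h = subst (λ z → μ z ≡ 0ℤ) (lem₂ j (+ s₂))
      (zero-below T (harmonic T T*≤T) (zero-from d T T*≤T above))
    where
    T : ℤ
    T = j + + s₂
    T*≤T : T* ≤ T
    T*≤T = ZP.≤-trans T*≤j (ZP.i≤i+j j (+ s₂))
    lem : ∀ j s c d → j + s ≡ (c - d) + ((j - (c - (1ℤ + d))) + (s - 1ℤ))
    lem = solve-∀
    above : C - + d ≤ T
    above = ≤-offset _ (+-nonneg (ZP.i≤j⇒0≤j-i h) (ZP.i≤j⇒0≤j-i (+≤+ s₂≥1))) (lem j (+ s₂) C (+ d))
    lem₂ : ∀ j s → j + s - s ≡ j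
    lem₂ = solve-∀

  decay : ∀ j → T* ≤ j → μ j ≡ 0ℤ
  decay j T*≤j = zero-from ∣ C - j ∣ j T*≤j (≤-offset _ (ZP.i≤j⇒0≤j-i (i≤∣i∣ (C - j))) (lem j C (+ ∣ C - j ∣)))
    where
    lem : ∀ j c a → j ≡ (c - a) + (a - (c - j))
    lem = solve-∀

subharmonic-decay : (s₁ s₂ : ℕ) → 1 ℕ.≤ s₂ → (μ : ℤ → ℤ) → (n M₀ C : ℤ) →
  (∀ j → (0ℤ ≤ μ j) × (μ j ≤ n)) → (∀ j → M₀ ≤ j → 0ℤ ≤ Lap s₁ s₂ μ j) →
  (∀ j → C ≤ j → μ j ≡ 0ℤ) →
  ∀ j → M₀ + decayLength s₁ s₂ n ≤ j → μ j ≡ 0ℤ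
subharmonic-decay s₁ s₂ s₂≥1 μ n M₀ C bounded subharmonic vanishing =
  DecayProof.decay s₁ s₂ s₂≥1 μ n M₀ C bounded subharmonic vanishing

stencil-cong : ∀ {a b c d e a' b' c' d' e' : ℤ} → a ≡ a' → b ≡ b' → c ≡ c' → d ≡ d' → e ≡ e' →
  (a + b + c + d) - + 4 * e ≡ (a' + b' + c' + d') - + 4 * e'
stencil-cong refl refl refl refl refl = refl

module Ramp (p : ℤ) (qn : ℕ) where
  q : ℤ
  q = + qn

  F : Fun
  F = Fpq p q

  N : ℤ → ℤ → ℤ
  N x y = p * x + q * y

  -- M = |p| + q bounds the change of N between neighbouring points.
  Mn : ℕ
  Mn = ∣ p ∣ ℕ.+ qn

  M : ℤ
  M = + Mn

  N+x : ∀ x y → N (x + 1ℤ) y ≡ N x y + p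
  N+x x y = lem p q x y where
    lem : ∀ p q x y → p * (x + 1ℤ) + q * y ≡ p * x + q * y + p
    lem = solve-∀
  N-x : ∀ x y → N (x - 1ℤ) y ≡ N x y - p
  N-x x y = lem p q x y where
    lem : ∀ p q x y → p * (x - 1ℤ) + q * y ≡ p * x + q * y - p
    lem = solve-∀
  N+y : ∀ x y → N x (y + 1ℤ) ≡ N x y + q
  N+y x y = lem p q x y where
    lem : ∀ p q x y → p * x + q * (y + 1ℤ) ≡ p * x + q * y + q
    lem = solve-∀
  N-y : ∀ x y → N x (y - 1ℤ) ≡ N x y - q
  N-y x y = lem p q x y where
    lem : ∀ p q x y → p * x + q * (y - 1ℤ) ≡ p * x + q * y - q
    lem = solve-∀

  F≡0 : ∀ x y → 0ℤ ≤ N x y → F x y ≡ 0ℤ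
  F≡0 x y h = ZP.i≥j⇒i⊓j≡j h
  F≡N : ∀ x y → N x y ≤ 0ℤ → F x y ≡ N x y
  F≡N x y h = ZP.i≤j⇒i⊓j≡i h

  F≤0 : ∀ x y → F x y ≤ 0ℤ
  F≤0 x y = ZP.i⊓j≤j (N x y) 0ℤ
  F≤N : ∀ x y → F x y ≤ N x y
  F≤N x y = ZP.i⊓j≤i (N x y) 0ℤ

  ∣p∣+p≥0 : 0ℤ ≤ + ∣ p ∣ + p
  ∣p∣+p≥0 = subst (_≤ + ∣ p ∣ + p) (ZP.+-inverseˡ p) (ZP.+-monoˡ-≤ p (-i≤∣i∣ p))
  ∣p∣-p≥0 : 0ℤ ≤ + ∣ p ∣ - p
  ∣p∣-p≥0 = ZP.i≤j⇒0≤j-i (i≤∣i∣ p)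

  offset-above : ∀ v d → ∣ d ∣ ℕ.≤ Mn → M ≤ v → 0ℤ ≤ v + d
  offset-above v d ∣d∣≤M M≤v =
    ≤-offset _ (+-nonneg (+-nonneg (ZP.i≤j⇒0≤j-i M≤v) (ZP.i≤j⇒0≤j-i (+≤+ ∣d∣≤M))) (ZP.i≤j⇒0≤j-i (-i≤∣i∣ d)))
               (lem v d M (+ ∣ d ∣))
    where
    lem : ∀ v d m a → v + d ≡ 0ℤ + ((v - m) + (m - a) + (a - - d))
    lem = solve-∀

  offset-below : ∀ v d → ∣ d ∣ ℕ.≤ Mn → v ≤ - M → v + d ≤ 0ℤ
  offset-below v d ∣d∣≤M v≤-M =
    ≤-offset _ (+-nonneg (+-nonneg (ZP.i≤j⇒0≤j-i v≤-M) (ZP.i≤j⇒0≤j-i (+≤+ ∣d∣≤M))) (ZP.i≤j⇒0≤j-i (i≤∣i∣ d)))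
               (lem v d M (+ ∣ d ∣))
    where
    lem : ∀ v d m a → 0ℤ ≡ v + d + ((- m - v) + (m - a) + (a - d))
    lem = solve-∀

  ∣p∣≤M : ∣ p ∣ ℕ.≤ Mn
  ∣p∣≤M = NP.m≤m+n ∣ p ∣ qn
  ∣-p∣≤M : ∣ - p ∣ ℕ.≤ Mn
  ∣-p∣≤M = subst (ℕ._≤ Mn) (sym (ZP.∣-i∣≡∣i∣ p)) ∣p∣≤M
  ∣q∣≤M : ∣ q ∣ ℕ.≤ Mn
  ∣q∣≤M = NP.m≤n+m qn ∣ p ∣
  ∣-q∣≤M : ∣ - q ∣ ℕ.≤ Mn
  ∣-q∣≤M = subst (ℕ._≤ Mn) (sym (ZP.∣-i∣≡∣i∣ q)) ∣q∣≤M

  -- F is harmonic wherever |N| ≥ M: there F is 0 or N on the whole stencil.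
  ΔF≡0 : ∀ x y → Mn ℕ.≤ ∣ N x y ∣ → Δ F x y ≡ 0ℤ
  ΔF≡0 x y h with k≤∣j∣⇒±k (N x y) Mn h
  ... | inj₁ M≤N = stencil-cong
          (F≡0 _ _ (subst (0ℤ ≤_) (sym (N+x x y)) (offset-above _ p ∣p∣≤M M≤N)))
          (F≡0 _ _ (subst (0ℤ ≤_) (sym (N-x x y)) (offset-above _ (- p) ∣-p∣≤M M≤N)))
          (F≡0 _ _ (subst (0ℤ ≤_) (sym (N+y x y)) (offset-above _ q ∣q∣≤M M≤N)))
          (F≡0 _ _ (subst (0ℤ ≤_) (sym (N-y x y)) (offset-above _ (- q) ∣-q∣≤M M≤N)))
          (F≡0 _ _ (ZP.≤-trans (ℕ-nonneg Mn) M≤N))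
  ... | inj₂ N≤-M = trans (stencil-cong
          (F≡N _ _ (subst (_≤ 0ℤ) (sym (N+x x y)) (offset-below _ p ∣p∣≤M N≤-M)))
          (F≡N _ _ (subst (_≤ 0ℤ) (sym (N-x x y)) (offset-below _ (- p) ∣-p∣≤M N≤-M)))
          (F≡N _ _ (subst (_≤ 0ℤ) (sym (N+y x y)) (offset-below _ q ∣q∣≤M N≤-M)))
          (F≡N _ _ (subst (_≤ 0ℤ) (sym (N-y x y)) (offset-below _ (- q) ∣-q∣≤M N≤-M)))
          (F≡N _ _ (ZP.≤-trans N≤-M (ZP.neg-mono-≤ (ℕ-nonneg Mn)))))
          (ΔN≡0 p q x y)
    where
    ΔN≡0 : ∀ p q x y → (p * (x + 1ℤ) + q * y) + (p * (x - 1ℤ) + q * y) + (p * x + q * (y + 1ℤ))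
                         + (p * x + q * (y - 1ℤ)) - + 4 * (p * x + q * y) ≡ 0ℤ
    ΔN≡0 = solve-∀

-- Rigidity of Θ_n(F) far from the line N = 0.

-- Beyond this value of |N| every element of Θ_n(F) coincides with F.
rigidityRadius : ℤ → ℕ → ℤ → ℤ
rigidityRadius p qn n = + (∣ p ∣ ℕ.+ qn) + decayLength ∣ p ∣ qn n

neighbours-∣p∣ : ∀ (μ : ℤ → ℤ) j p → μ (j + p) + μ (j - p) ≡ μ (j + + ∣ p ∣) + μ (j - + ∣ p ∣)
neighbours-∣p∣ μ j (+ k) = refl
neighbours-∣p∣ μ j -[1+ k ] = ZP.+-comm (μ (j - + suc k)) (μ (j + + suc k))

¬¬-excluded-middle : ∀ (P : Set) → ¬ ¬ (P ⊎ ¬ P)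
¬¬-excluded-middle P k = k (inj₂ (λ x → k (inj₁ x)))

-- For G ∈ Θ_n(F), the defect φ = F - G takes values in [0,n], is subharmonic
-- where |N| ≥ M (F is harmonic there, G superharmonic) and vanishes where |N|
-- is large (the band condition).  Its maxima μ(j) over the lines N = j then
-- form a one-dimensional profile, subharmonic for |j| ≥ M with steps |p| and
-- q, to which the decay lemma applies at both ends.  The maxima exist only
-- classically, i.e. under double negation, which is harmless because the
-- conclusion G(x,y) = F(x,y) is decidable.
module Rigidity (p : ℤ) (qn : ℕ) (qn≥1 : 1 ℕ.≤ qn) (n : ℤ) (G : Fun) (G∈Θ : InΘ n (Fpq p (+ qn)) G) where
  open Ramp p qn

  φ : Fun
  φ x y = F x y - G x y

  φ≥0 : ∀ x y → 0ℤ ≤ φ x y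
  φ≥0 x y = ZP.i≤j⇒0≤j-i (proj₁ (proj₂ (proj₂ G∈Θ)) x y)

  φ≤n : ∀ x y → φ x y ≤ n
  φ≤n x y = ≤-offset _ (ZP.i≤j⇒0≤j-i (proj₁ (proj₂ G∈Θ) x y)) (lem (F x y) (G x y) n)
    where
    lem : ∀ f g n → n ≡ (f - g) + (g - (f - n))
    lem = solve-∀

  n≥0 : 0ℤ ≤ n
  n≥0 = ZP.≤-trans (φ≥0 0ℤ 0ℤ) (φ≤n 0ℤ 0ℤ)

  Δφ≥0 : ∀ x y → Mn ℕ.≤ ∣ N x y ∣ → 0ℤ ≤ Δ φ x y
  Δφ≥0 x y h = subst (0ℤ ≤_) (sym Δφ≡-ΔG) (ZP.neg-mono-≤ (proj₁ G∈Θ x y))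
    where
    Δ-diff : ∀ a₁ a₂ a₃ a₄ a₅ b₁ b₂ b₃ b₄ b₅ →
      ((a₁ - b₁) + (a₂ - b₂) + (a₃ - b₃) + (a₄ - b₄)) - + 4 * (a₅ - b₅)
        ≡ ((a₁ + a₂ + a₃ + a₄) - + 4 * a₅) - ((b₁ + b₂ + b₃ + b₄) - + 4 * b₅)
    Δ-diff = solve-∀
    Δφ≡-ΔG : Δ φ x y ≡ - Δ G x y
    Δφ≡-ΔG = trans (Δ-diff (F (x + 1ℤ) y) (F (x - 1ℤ) y) (F x (y + 1ℤ)) (F x (y - 1ℤ)) (F x y)
                           (G (x + 1ℤ) y) (G (x - 1ℤ) y) (G x (y + 1ℤ)) (G x (y - 1ℤ)) (G x y))
             (trans (cong (_- Δ G x y) (ΔF≡0 x y h)) (ZP.+-identityˡ _))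

  C : ℕ
  C = proj₁ (proj₂ (proj₂ (proj₂ G∈Θ)))

  band : ∀ x y → F x y ≢ G x y →
    Σ ℤ λ x' → Σ ℤ λ y' → (Δ F x' y' ≢ 0ℤ) × (dist² x y x' y' ≤ + C * + C)
  band = proj₂ (proj₂ (proj₂ (proj₂ (proj₂ G∈Θ))))

  Cbn : ℕ
  Cbn = Mn ℕ.+ (∣ p ∣ ℕ.+ qn) ℕ.* C

  Cb : ℤ
  Cb = + Cbn

  -- Where G ≠ F there is a point of D(F), hence with |N| < M, within
  -- distance C; moving by (dx,dy) changes N by at most (|p| + q) C.
  φ≡0-far : ∀ x y → Cbn ℕ.≤ ∣ N x y ∣ → φ x y ≡ 0ℤ
  φ≡0-far x y h with φ x y ZP.≟ 0ℤ
  ... | yes e = e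
  ... | no φ≢0 = ⊥-elim (NP.<⇒≱ (∣N∣<Cb (band x y F≢G)) h)
    where
    F≢G : F x y ≢ G x y
    F≢G e = φ≢0 (trans (cong (λ z → F x y - z) (sym e)) (ZP.+-inverseʳ (F x y)))
    ∣N∣<Cb : Σ ℤ (λ x' → Σ ℤ λ y' → (Δ F x' y' ≢ 0ℤ) × (dist² x y x' y' ≤ + C * + C)) → ∣ N x y ∣ ℕ.< Cbn
    ∣N∣<Cb (x' , y' , deviates , close) = begin-strict
        ∣ N x y ∣
      ≡⟨ cong ∣_∣ (lem p q x y x' y') ⟩
        ∣ N x' y' + (p * (x - x') + q * (y - y')) ∣
      ≤⟨ ZP.∣i+j∣≤∣i∣+∣j∣ (N x' y') _ ⟩
        ∣ N x' y' ∣ ℕ.+ ∣ p * (x - x') + q * (y - y') ∣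
      ≤⟨ NP.+-monoʳ-≤ ∣ N x' y' ∣ (ZP.∣i+j∣≤∣i∣+∣j∣ (p * (x - x')) (q * (y - y'))) ⟩
        ∣ N x' y' ∣ ℕ.+ (∣ p * (x - x') ∣ ℕ.+ ∣ q * (y - y') ∣)
      ≡⟨ cong (∣ N x' y' ∣ ℕ.+_) (cong₂ ℕ._+_ (ZP.∣i*j∣≡∣i∣*∣j∣ p (x - x')) (ZP.∣i*j∣≡∣i∣*∣j∣ q (y - y'))) ⟩
        ∣ N x' y' ∣ ℕ.+ (∣ p ∣ ℕ.* ∣ x - x' ∣ ℕ.+ qn ℕ.* ∣ y - y' ∣)
      ≤⟨ NP.+-monoʳ-≤ ∣ N x' y' ∣ (NP.+-mono-≤ (NP.*-monoʳ-≤ ∣ p ∣ (proj₁ dxy)) (NP.*-monoʳ-≤ qn (proj₂ dxy))) ⟩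
        ∣ N x' y' ∣ ℕ.+ (∣ p ∣ ℕ.* C ℕ.+ qn ℕ.* C)
      ≡⟨ cong (∣ N x' y' ∣ ℕ.+_) (sym (NP.*-distribʳ-+ C ∣ p ∣ qn)) ⟩
        ∣ N x' y' ∣ ℕ.+ (∣ p ∣ ℕ.+ qn) ℕ.* C
      <⟨ NP.+-monoˡ-< ((∣ p ∣ ℕ.+ qn) ℕ.* C) ∣N'∣<M ⟩
        Cbn ∎
      where
      open NP.≤-Reasoning
      lem : ∀ p q x y x' y' → p * x + q * y ≡ (p * x' + q * y') + (p * (x - x') + q * (y - y'))
      lem = solve-∀
      dxy = coordinate-bound (x - x') (y - y') C close
      ∣N'∣<M : ∣ N x' y' ∣ ℕ.< Mn
      ∣N'∣<M with Mn ℕ.≤? ∣ N x' y' ∣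
      ... | yes M≤∣N'∣ = ⊥-elim (deviates (ΔF≡0 x' y' M≤∣N'∣))
      ... | no M≰∣N'∣ = NP.≰⇒> M≰∣N'∣

  LineMax : ℤ → ℤ → Set
  LineMax j m = (∀ x y → N x y ≡ j → φ x y ≤ m) ×
                ((m ≡ 0ℤ) ⊎ (Σ ℤ λ x → Σ ℤ λ y → (N x y ≡ j) × (φ x y ≡ m)))

  line-max-below : ∀ j k → (∀ x y → N x y ≡ j → φ x y ≤ + k) → ¬ ¬ Σ ℤ (LineMax j)
  line-max-below j zero φ≤0 k = k (0ℤ , φ≤0 , inj₁ refl)
  line-max-below j (suc k) φ≤1+k c = ¬¬-excluded-middle Attained decide
    where
    Attained : Set
    Attained = Σ ℤ λ x → Σ ℤ λ y → (N x y ≡ j) × (+ suc k ≤ φ x y)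
    φ≤k : ¬ Attained → ∀ x y → N x y ≡ j → φ x y ≤ + k
    φ≤k ¬att x y e = ZP.i<j⇒i≤pred[j] {j = + suc k}
      (ZP.≤∧≢⇒< (φ≤1+k x y e) (λ φ≡1+k → ¬att (x , y , e , ZP.≤-reflexive (sym φ≡1+k))))
    decide : Attained ⊎ ¬ Attained → ⊥
    decide (inj₁ (x , y , e , ≥1+k)) = c (+ suc k , φ≤1+k , inj₂ (x , y , e , ZP.≤-antisym (φ≤1+k x y e) ≥1+k))
    decide (inj₂ ¬att) = line-max-below j k (φ≤k ¬att) c

  line-max : ∀ j → ¬ ¬ Σ ℤ (LineMax j)
  line-max j = line-max-below j ∣ n ∣ (λ x y _ → subst (φ x y ≤_) (sym (ZP.0≤i⇒+∣i∣≡i n≥0)) (φ≤n x y))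

  φ≡0-above : ∀ x y → Cb ≤ N x y → φ x y ≡ 0ℤ
  φ≡0-above x y h = φ≡0-far x y (k≤j⇒k≤∣j∣ _ _ h)
  φ≡0-below : ∀ x y → N x y ≤ - Cb → φ x y ≡ 0ℤ
  φ≡0-below x y h = φ≡0-far x y (j≤-k⇒k≤∣j∣ _ _ h)

  line-max-far : ∀ j → (j ≤ - Cb) ⊎ (Cb ≤ j) → LineMax j 0ℤ
  line-max-far j (inj₁ h) = (λ x y e → ZP.≤-reflexive (φ≡0-below x y (subst (_≤ - Cb) (sym e) h))) , inj₁ refl
  line-max-far j (inj₂ h) = (λ x y e → ZP.≤-reflexive (φ≡0-above x y (subst (Cb ≤_) (sym e) h))) , inj₁ refl

  update : (ℤ → ℤ) → ℤ → ℤ → ℤ → ℤ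
  update μ j₀ m₀ j with j ZP.≟ j₀
  ... | yes _ = m₀
  ... | no _ = μ j

  -- Finitely many maxima can be chosen at once (all but finitely many are 0).
  profile-upto : ∀ k → ¬ ¬ Σ (ℤ → ℤ) (λ μ → ∀ j → j ≤ - Cb + + k → LineMax j (μ j))
  profile-upto zero c = c ((λ _ → 0ℤ) , λ j h → line-max-far j (inj₁ (subst (j ≤_) (ZP.+-identityʳ _) h)))
  profile-upto (suc k) c =
    profile-upto k (λ { (μ , hμ) → line-max j₀ (λ { (m₀ , hm₀) → c (update μ j₀ m₀ , extend μ hμ m₀ hm₀) }) })
    where
    j₀ : ℤ
    j₀ = - Cb + + k + 1ℤ
    j₀≡ : j₀ ≡ - Cb + + suc k
    j₀≡ = trans (ZP.+-assoc (- Cb) (+ k) 1ℤ) (cong (λ z → - Cb + + z) (NP.+-comm k 1))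
    extend : ∀ μ → (∀ j → j ≤ - Cb + + k → LineMax j (μ j)) → ∀ m₀ → LineMax j₀ m₀ →
             ∀ j → j ≤ - Cb + + suc k → LineMax j (update μ j₀ m₀ j)
    extend μ hμ m₀ hm₀ j h with j ZP.≟ j₀
    ... | yes e = subst (λ z → LineMax z m₀) (sym e) hm₀
    ... | no ne = hμ j (j≤i+1∧j≢i+1⇒j≤i (subst (j ≤_) (sym j₀≡) h) ne)

  profile : ¬ ¬ Σ (ℤ → ℤ) λ μ → ∀ j → LineMax j (μ j)
  profile c = profile-upto ∣ Cb - (- Cb) ∣ (λ { (μ , hμ) → c (truncate μ , spec μ hμ) })
    where
    truncate : (ℤ → ℤ) → ℤ → ℤ
    truncate μ j with Cb ZP.≤? j
    ... | yes _ = 0ℤ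
    ... | no _ = μ j
    spec : ∀ μ → (∀ j → j ≤ - Cb + + ∣ Cb - (- Cb) ∣ → LineMax j (μ j)) → ∀ j → LineMax j (truncate μ j)
    spec μ hμ j with Cb ZP.≤? j
    ... | yes h = line-max-far j (inj₂ h)
    ... | no h = hμ j (ZP.≤-trans (ZP.<⇒≤ (ZP.≰⇒> h)) (j≤i+∣j-i∣ (- Cb) Cb))

  module Profile (μ : ℤ → ℤ) (μ-max : ∀ j → LineMax j (μ j)) where
    bounded : ∀ j → (0ℤ ≤ μ j) × (μ j ≤ n)
    bounded j with proj₂ (μ-max j)
    ... | inj₁ e = subst (0ℤ ≤_) (sym e) ZP.≤-refl , subst (_≤ n) (sym e) n≥0
    ... | inj₂ (x , y , _ , e) = subst (0ℤ ≤_) e (φ≥0 x y) , subst (_≤ n) e (φ≤n x y)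

    vanishing-above : ∀ j → Cb ≤ j → μ j ≡ 0ℤ
    vanishing-above j h with proj₂ (μ-max j)
    ... | inj₁ e = e
    ... | inj₂ (x , y , e , eq) = trans (sym eq) (φ≡0-above x y (subst (Cb ≤_) (sym e) h))

    vanishing-below : ∀ j → j ≤ - Cb → μ j ≡ 0ℤ
    vanishing-below j h with proj₂ (μ-max j)
    ... | inj₁ e = e
    ... | inj₂ (x , y , e , eq) = trans (sym eq) (φ≡0-below x y (subst (_≤ - Cb) (sym e) h))

    -- At a maximiser (x,y) of the line N = j, Lap μ (j) dominates Δφ (x,y),
    -- since the neighbours of (x,y) lie on the lines j ± p, j ± q.
    subharmonic : ∀ j → Mn ℕ.≤ ∣ j ∣ → 0ℤ ≤ Lap (∣ p ∣) qn μ j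
    subharmonic j h with proj₂ (μ-max j)
    ... | inj₁ e = subst (0ℤ ≤_) (sym (trans (cong (λ z → neighbours - + 4 * z) e) (lem neighbours)))
                     (+-nonneg (+-nonneg (+-nonneg (proj₁ (bounded _)) (proj₁ (bounded _))) (proj₁ (bounded _)))
                               (proj₁ (bounded _)))
      where
      neighbours : ℤ
      neighbours = μ (j + + ∣ p ∣) + μ (j - + ∣ p ∣) + μ (j + q) + μ (j - q)
      lem : ∀ x → x - + 4 * 0ℤ ≡ x
      lem = solve-∀
    ... | inj₂ (x , y , e , eq) =
      subst (0ℤ ≤_) (sym Lap≡)
        (+-nonneg (Δφ≥0 x y (subst (λ z → Mn ℕ.≤ ∣ z ∣) (sym e) h))
                  (+-nonneg (+-nonneg (+-nonneg (gap (N+x x y) (cong (_+ p) e)) (gap (N-x x y) (cong (_- p) e)))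
                                      (gap (N+y x y) (cong (_+ q) e)))
                            (gap (N-y x y) (cong (_- q) e))))
      where
      gap : ∀ {x' y' k k'} → N x' y' ≡ k → k ≡ k' → 0ℤ ≤ μ k' - φ x' y'
      gap {x'} {y'} e₁ e₂ = ZP.i≤j⇒0≤j-i (proj₁ (μ-max _) x' y' (trans e₁ e₂))
      lem : ∀ a b c d f₁ f₂ f₃ f₄ f₅ → a + b + c + d - + 4 * f₅
            ≡ ((f₁ + f₂ + f₃ + f₄) - + 4 * f₅) + ((a - f₁) + (b - f₂) + (c - f₃) + (d - f₄))
      lem = solve-∀
      Lap≡ : Lap (∣ p ∣) qn μ j ≡ Δ φ x y + ((μ (j + p) - φ (x + 1ℤ) y) + (μ (j - p) - φ (x - 1ℤ) y)
                                           + (μ (j + q) - φ x (y + 1ℤ)) + (μ (j - q) - φ x (y - 1ℤ)))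
      Lap≡ = trans (cong₂ (λ a b → a + μ (j + q) + μ (j - q) - + 4 * b) (sym (neighbours-∣p∣ μ j p)) (sym eq))
                   (lem (μ (j + p)) (μ (j - p)) (μ (j + q)) (μ (j - q))
                        (φ (x + 1ℤ) y) (φ (x - 1ℤ) y) (φ x (y + 1ℤ)) (φ x (y - 1ℤ)) (φ x y))

    decay-above : ∀ j → rigidityRadius p qn n ≤ j → μ j ≡ 0ℤ
    decay-above = subharmonic-decay ∣ p ∣ qn qn≥1 μ n M Cb bounded
                    (λ j h → subharmonic j (k≤j⇒k≤∣j∣ j Mn h)) vanishing-above

    Lap-mirror : ∀ j → Lap (∣ p ∣) qn (λ i → μ (- i)) j ≡ Lap (∣ p ∣) qn μ (- j)
    Lap-mirror j = trans (stencil-cong (cong μ (-[j+s] j (+ ∣ p ∣))) (cong μ (-[j-s] j (+ ∣ p ∣)))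
                                       (cong μ (-[j+s] j q)) (cong μ (-[j-s] j q)) refl)
                         (lem (μ (- j + + ∣ p ∣)) (μ (- j - + ∣ p ∣)) (μ (- j + q)) (μ (- j - q)) (μ (- j)))
      where
      -[j+s] : ∀ j s → - (j + s) ≡ - j - s
      -[j+s] = solve-∀
      -[j-s] : ∀ j s → - (j - s) ≡ - j + s
      -[j-s] = solve-∀
      lem : ∀ a b c d m → b + a + d + c - + 4 * m ≡ a + b + c + d - + 4 * m
      lem = solve-∀

    decay-below : ∀ j → rigidityRadius p qn n ≤ j → μ (- j) ≡ 0ℤ
    decay-below = subharmonic-decay ∣ p ∣ qn qn≥1 (λ i → μ (- i)) n M Cb (λ j → bounded (- j))
      (λ j h → subst (0ℤ ≤_) (sym (Lap-mirror j))
                 (subharmonic (- j) (subst (Mn ℕ.≤_) (sym (ZP.∣-i∣≡∣i∣ j)) (k≤j⇒k≤∣j∣ j Mn h))))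
      (λ j h → vanishing-below (- j) (ZP.neg-mono-≤ h))

  G≡F-far : ∀ x y → (rigidityRadius p qn n ≤ N x y) ⊎ (N x y ≤ - rigidityRadius p qn n) → G x y ≡ F x y
  G≡F-far x y far with G x y ZP.≟ F x y
  ... | yes e = e
  ... | no G≢F = ⊥-elim (profile (λ { (μ , μ-max) → G≢F (G≡F μ μ-max) }))
    where
    G≡F : ∀ μ → (∀ j → LineMax j (μ j)) → G x y ≡ F x y
    G≡F μ μ-max = sym (trans (lem (G x y) (F x y)) (trans (cong (λ z → G x y + z) φ≡0) (ZP.+-identityʳ (G x y))))
      where
      open Profile μ μ-max
      lem : ∀ g f → f ≡ g + (f - g)
      lem = solve-∀
      μ≡0 : (rigidityRadius p qn n ≤ N x y) ⊎ (N x y ≤ - rigidityRadius p qn n) → μ (N x y) ≡ 0ℤ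
      μ≡0 (inj₁ above) = decay-above _ above
      μ≡0 (inj₂ below) = subst (λ z → μ z ≡ 0ℤ) (ZP.neg-involutive (N x y))
        (decay-below _ (subst (_≤ - N x y) (ZP.neg-involutive _) (ZP.neg-mono-≤ below)))
      φ≡0 : φ x y ≡ 0ℤ
      φ≡0 = ZP.≤-antisym (subst (φ x y ≤_) (μ≡0 far) (proj₁ (μ-max (N x y)) x y refl)) (φ≥0 x y)

-- Properties of S = S_n(F).

module Translation (p : ℤ) (qn : ℕ) (n : ℤ) (u w : ℤ)
  (F-invariant : ∀ x y → Fpq p (+ qn) (x + u) (y + w) ≡ Fpq p (+ qn) x y) where
  open Ramp p qn

  Δ-shift : ∀ (G : Fun) x y → Δ (λ a b → G (a + u) (b + w)) x y ≡ Δ G (x + u) (y + w)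
  Δ-shift G x y = stencil-cong (cong (λ z → G z (y + w)) (+1-comm x u)) (cong (λ z → G z (y + w)) (-1-comm x u))
                               (cong (G (x + u)) (+1-comm y w)) (cong (G (x + u)) (-1-comm y w)) refl
    where
    +1-comm : ∀ x u → x + 1ℤ + u ≡ x + u + 1ℤ
    +1-comm = solve-∀
    -1-comm : ∀ x u → x - 1ℤ + u ≡ x + u - 1ℤ
    -1-comm = solve-∀

  ΔF-invariant : ∀ x y → Δ F (x + u) (y + w) ≡ Δ F x y
  ΔF-invariant x y = trans (sym (Δ-shift F x y))
    (stencil-cong (F-invariant _ _) (F-invariant _ _) (F-invariant _ _) (F-invariant _ _) (F-invariant _ _))

  shift∈Θ : ∀ G → InΘ n F G → InΘ n F (λ x y → G (x + u) (y + w))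
  shift∈Θ G (sup , lo , hi , (C , C>0 , band)) =
    (λ x y → subst (_≤ 0ℤ) (sym (Δ-shift G x y)) (sup _ _)) ,
    (λ x y → subst (λ z → z - n ≤ G (x + u) (y + w)) (F-invariant x y) (lo _ _)) ,
    (λ x y → subst (G (x + u) (y + w) ≤_) (F-invariant x y) (hi _ _)) ,
    (C , C>0 , λ x y ne → shift-witness x y (band (x + u) (y + w) (λ e → ne (trans (sym (F-invariant x y)) e))))
    where
    shift-witness : ∀ x y →
      Σ ℤ (λ x' → Σ ℤ λ y' → (Δ F x' y' ≢ 0ℤ) × (dist² (x + u) (y + w) x' y' ≤ + C * + C)) →
      Σ ℤ (λ x' → Σ ℤ λ y' → (Δ F x' y' ≢ 0ℤ) × (dist² x y x' y' ≤ + C * + C))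
    shift-witness x y (x' , y' , deviates , close) = x' - u , y' - w ,
      (λ e → deviates (trans (trans (cong₂ (Δ F) (sym (-s+s x' u)) (sym (-s+s y' w))) (ΔF-invariant (x' - u) (y' - w))) e)) ,
      subst (_≤ + C * + C) (dist-shift x y x' y' u w) close
      where
      -s+s : ∀ x u → x - u + u ≡ x
      -s+s = solve-∀
      dist-shift : ∀ x y x' y' u w → (x + u - x') * (x + u - x') + (y + w - y') * (y + w - y')
                   ≡ (x - (x' - u)) * (x - (x' - u)) + (y - (y' - w)) * (y - (y' - w))
      dist-shift = solve-∀

module Minimum (p : ℤ) (qn : ℕ) (qn≥1 : 1 ℕ.≤ qn) (n : ℤ) (S : Fun) (S-min : IsS n (Fpq p (+ qn)) S) where
  open Ramp p qn

  attained : ∀ x y → Σ Fun λ G → InΘ n F G × (G x y ≡ S x y)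
  attained x y = proj₁ (S-min x y)

  S≤G : ∀ x y G → InΘ n F G → S x y ≤ G x y
  S≤G x y = proj₂ (S-min x y)

  S≤F : ∀ x y → S x y ≤ F x y
  S≤F x y with attained x y
  ... | G , G∈Θ , e = subst (_≤ F x y) e (proj₁ (proj₂ (proj₂ G∈Θ)) x y)

  S≤0 : ∀ x y → S x y ≤ 0ℤ
  S≤0 x y = ZP.≤-trans (S≤F x y) (F≤0 x y)

  -- A minimum of superharmonic functions is superharmonic: compare with the
  -- minimiser G at (x,y), which lies above S at the neighbours.
  S-superharmonic : Superharmonic S
  S-superharmonic x y with attained x y
  ... | G , G∈Θ , e = ZP.≤-trans (subst (λ z → neighbours - + 4 * z ≤ Δ G x y) e
                                    (ZP.+-monoˡ-≤ (- (+ 4 * G x y)) S≤G-neighbours))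
                                 (proj₁ G∈Θ x y)
    where
    neighbours : ℤ
    neighbours = S (x + 1ℤ) y + S (x - 1ℤ) y + S x (y + 1ℤ) + S x (y - 1ℤ)
    S≤G-neighbours : neighbours ≤ G (x + 1ℤ) y + G (x - 1ℤ) y + G x (y + 1ℤ) + G x (y - 1ℤ)
    S≤G-neighbours = ZP.+-mono-≤ (ZP.+-mono-≤ (ZP.+-mono-≤ (S≤G _ _ G G∈Θ) (S≤G _ _ G G∈Θ)) (S≤G _ _ G G∈Θ))
                                 (S≤G _ _ G G∈Θ)

  S-periodic : ∀ x y → S (x + q) (y + - p) ≡ S x y
  S-periodic x y = ZP.≤-antisym back forth
    where
    F-period : ∀ x y → F (x + q) (y + - p) ≡ F x y
    F-period x y = cong (_⊓ 0ℤ) (lem p q x y) where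
      lem : ∀ p q x y → p * (x + q) + q * (y + - p) ≡ p * x + q * y
      lem = solve-∀
    F-period⁻ : ∀ x y → F (x + - q) (y + p) ≡ F x y
    F-period⁻ x y = cong (_⊓ 0ℤ) (lem p q x y) where
      lem : ∀ p q x y → p * (x + - q) + q * (y + p) ≡ p * x + q * y
      lem = solve-∀
    forth : S x y ≤ S (x + q) (y + - p)
    forth with attained (x + q) (y + - p)
    ... | G , G∈Θ , e = subst (S x y ≤_) e (S≤G x y _ (Translation.shift∈Θ p qn n q (- p) F-period G G∈Θ))
    back : S (x + q) (y + - p) ≤ S x y
    back with attained x y
    ... | G , G∈Θ , e = subst (S (x + q) (y + - p) ≤_) (trans (cong₂ G (lem x q) (lem₂ y p)) e)
                              (S≤G _ _ _ (Translation.shift∈Θ p qn n (- q) p F-period⁻ G G∈Θ))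
      where
      lem : ∀ x q → x + q + - q ≡ x
      lem = solve-∀
      lem₂ : ∀ y p → y + - p + p ≡ y
      lem₂ = solve-∀

  n≥0 : 0ℤ ≤ n
  n≥0 = Rigidity.n≥0 p qn qn≥1 n (proj₁ (attained 0ℤ 0ℤ)) (proj₁ (proj₂ (attained 0ℤ 0ℤ)))

  R : ℤ
  R = rigidityRadius p qn n

  R≥0 : 0ℤ ≤ R
  R≥0 = +-nonneg (ℕ-nonneg Mn) (+-nonneg (*-nonneg (ℕ-nonneg ∣ p ∣) (*-nonneg (ℕ-nonneg ∣ p ∣) n≥0))
                                         (*-nonneg (ℕ-nonneg qn) (*-nonneg (ℕ-nonneg qn) n≥0)))

  S≡F-far : ∀ x y → (R ≤ N x y) ⊎ (N x y ≤ - R) → S x y ≡ F x y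
  S≡F-far x y far with attained x y
  ... | G , G∈Θ , e = trans (sym e) (Rigidity.G≡F-far p qn qn≥1 n G G∈Θ x y far)

  S≡0-above : ∀ x y → R ≤ N x y → S x y ≡ 0ℤ
  S≡0-above x y h = trans (S≡F-far x y (inj₁ h)) (F≡0 x y (ZP.≤-trans R≥0 h))

  S≡N-below : ∀ x y → N x y ≤ - R → S x y ≡ N x y
  S≡N-below x y h = trans (S≡F-far x y (inj₂ h)) (F≡N x y (ZP.≤-trans h (ZP.neg-mono-≤ R≥0)))

prim : (ℤ → ℤ) → ℤ → ℤ
prim d (+ k) = sum k (λ i → d (+ i))
prim d -[1+ k ] = - sum (suc k) (λ i → d -[1+ i ])

prim-step : ∀ d y → prim d (y + 1ℤ) ≡ prim d y + d y
prim-step d (+ k) = cong (λ z → prim d (+ z)) (NP.+-comm k 1)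
prim-step d -[1+ zero ] = lem (d -[1+ 0 ]) where
  lem : ∀ a → 0ℤ ≡ - (0ℤ + a) + a
  lem = solve-∀
prim-step d -[1+ suc k ] = lem (sum (suc k) (λ i → d -[1+ i ])) (d -[1+ suc k ]) where
  lem : ∀ a b → - a ≡ - (a + b) + b
  lem = solve-∀

prim-const-steps : ∀ d a v k → (∀ i → i ℕ.< k → d (v + + i) ≡ a) → prim d (v + + k) ≡ prim d v + a * + k
prim-const-steps d a v zero h = trans (cong (prim d) (ZP.+-identityʳ v)) (lem (prim d v) a) where
  lem : ∀ x a → x ≡ x + a * 0ℤ
  lem = solve-∀
prim-const-steps d a v (suc k) h = begin
    prim d (v + + suc k)
  ≡⟨ cong (prim d) (sym (trans (ZP.+-assoc v (+ k) 1ℤ) (cong (λ z → v + + z) (NP.+-comm k 1)))) ⟩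
    prim d (v + + k + 1ℤ)
  ≡⟨ prim-step d (v + + k) ⟩
    prim d (v + + k) + d (v + + k)
  ≡⟨ cong₂ _+_ (prim-const-steps d a v k (λ i lt → h i (NP.m<n⇒m<1+n lt))) (h k NP.≤-refl) ⟩
    prim d v + a * + k + a
  ≡⟨ lem (prim d v) a (+ k) ⟩
    prim d v + a * (1ℤ + + k) ∎
  where
  open ≡-Reasoning
  lem : ∀ x a k → x + a * k + a ≡ x + a * (1ℤ + k)
  lem = solve-∀

prim-const-ordered : ∀ d a v u lo hi → lo ≤ v → v ≤ u → u ≤ hi → (∀ y → lo ≤ y → y ≤ hi → d y ≡ a) →
  prim d u - prim d v ≡ a * (u - v)
prim-const-ordered d a v u lo hi lo≤v v≤u u≤hi d≡a = begin
    prim d u - prim d v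
  ≡⟨ cong (λ z → prim d z - prim d v) (sym (i+∣j-i∣≡j v≤u)) ⟩
    prim d (v + + ∣ u - v ∣) - prim d v
  ≡⟨ cong (_- prim d v) (prim-const-steps d a v ∣ u - v ∣ (λ i lt → d≡a _ (ZP.≤-trans lo≤v (ZP.i≤i+j v (+ i)))
        (ZP.≤-trans (ZP.+-monoʳ-≤ v (ZP.<⇒≤ (+<+ lt))) (subst (_≤ hi) (sym (i+∣j-i∣≡j v≤u)) u≤hi)))) ⟩
    prim d v + a * + ∣ u - v ∣ - prim d v
  ≡⟨ cong (λ z → prim d v + a * z - prim d v) (trans (cong +_ (ZP.∣i-j∣≡∣j-i∣ u v)) (ZP.∣-∣-≤ v≤u)) ⟩
    prim d v + a * (u - v) - prim d v
  ≡⟨ lem (prim d v) (a * (u - v)) ⟩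
    a * (u - v) ∎
  where
  open ≡-Reasoning
  lem : ∀ x y → x + y - x ≡ y
  lem = solve-∀

prim-const : ∀ d a u v lo hi → lo ≤ u → lo ≤ v → u ≤ hi → v ≤ hi → (∀ y → lo ≤ y → y ≤ hi → d y ≡ a) →
  prim d u - prim d v ≡ a * (u - v)
prim-const d a u v lo hi lo≤u lo≤v u≤hi v≤hi d≡a with ZP.≤-total v u
... | inj₁ v≤u = prim-const-ordered d a v u lo hi lo≤v v≤u u≤hi d≡a
... | inj₂ u≤v = trans (lem (prim d u) (prim d v))
                       (trans (cong -_ (prim-const-ordered d a u v lo hi lo≤u u≤v v≤hi d≡a)) (lem₂ a u v))
  where
  lem : ∀ x y → x - y ≡ - (y - x)
  lem = solve-∀
  lem₂ : ∀ a u v → - (a * (v - u)) ≡ a * (u - v)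
  lem₂ = solve-∀

-- Cuts and their flux.

-- A cut through the (q,-p)-periodic function S is a choice of height h x in
-- each column x < q, continued periodically: the column after the last one is
-- column 0 lowered by p.  Its flux adds the vertical differences of S across
-- the cut and, along each step between consecutive columns, the horizontal
-- differences of S.  Raising the cut by one adds the Laplacians of S along it
-- (a discrete divergence theorem); hence for superharmonic S the flux is
-- nonincreasing as the cut moves up, and where it is constant S is harmonic
-- along the cuts.
module Cuts (p : ℤ) (k : ℕ) (S : Fun) (S-periodic : ∀ x y → S (x + + suc k) (y + - p) ≡ S x y)
            (S-superharmonic : Superharmonic S) where
  qn : ℕ
  qn = suc k

  next : (ℕ → ℤ) → ℕ → ℤ
  next h x with suc x ℕ.≟ qn
  ... | yes _ = h 0 - p
  ... | no _ = h (suc x)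

  ∂x : ℕ → ℤ → ℤ
  ∂x x y = S (+ suc x) y - S (+ x) y

  vertical : (ℕ → ℤ) → ℕ → ℤ
  vertical h x = S (+ x) (h x) - S (+ x) (h x - 1ℤ)

  horizontal : (ℕ → ℤ) → ℕ → ℤ
  horizontal h x = prim (∂x x) (h x) - prim (∂x x) (next h x)

  flux : (ℕ → ℤ) → ℤ
  flux h = sum qn (vertical h) + sum qn (horizontal h)

  raise : (ℕ → ℤ) → ℤ → ℕ → ℤ
  raise h c x = h x + c

  next-cong : ∀ h h' → (∀ x → h x ≡ h' x) → ∀ x → next h x ≡ next h' x
  next-cong h h' e x with suc x ℕ.≟ qn
  ... | yes _ = cong (_- p) (e 0)
  ... | no _ = e (suc x)

  flux-cong : ∀ h h' → (∀ x → h x ≡ h' x) → flux h ≡ flux h'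
  flux-cong h h' e =
    cong₂ _+_ (sum-cong qn (λ x _ → cong₂ (λ a b → S (+ x) a - S (+ x) (b - 1ℤ)) (e x) (e x)))
              (sum-cong qn (λ x _ → cong₂ (λ a b → prim (∂x x) a - prim (∂x x) b) (e x) (next-cong h h' e x)))

  next-raise : ∀ h c x → next (raise h c) x ≡ next h x + c
  next-raise h c x with suc x ℕ.≟ qn
  ... | yes _ = lem (h 0) c p where
    lem : ∀ a c p → a + c - p ≡ a - p + c
    lem = solve-∀
  ... | no _ = refl

  next-inner : ∀ h x → x ℕ.< k → next h x ≡ h (suc x)
  next-inner h x x<k with suc x ℕ.≟ qn
  ... | yes e = ⊥-elim (NP.<-irrefl (NP.suc-injective e) x<k)
  ... | no _ = refl

  next-last : ∀ h → next h k ≡ h 0 - p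
  next-last h with suc k ℕ.≟ qn
  ... | no ne = ⊥-elim (ne refl)
  ... | yes _ = refl

  ∂x⁻ : (ℕ → ℤ) → ℕ → ℤ
  ∂x⁻ h x = S (+ x) (h x) - S (+ x - 1ℤ) (h x)

  -- The differences at the next heights are the left differences of the next
  -- columns; for the last column this uses the periodicity of S.
  ∂x-next : ∀ h x → x ℕ.< qn → ∂x x (next h x) ≡ ∂x⁻ h (suc x) ⊎ (x ≡ k)
  ∂x-next h x x<q with suc x ℕ.≟ qn
  ... | yes e = inj₂ (NP.suc-injective e)
  ... | no _ = inj₁ (cong (λ z → S (+ suc x) (h (suc x)) - S z (h (suc x))) (sym (lem (+ x))))
    where
    lem : ∀ a → 1ℤ + a - 1ℤ ≡ a
    lem = solve-∀

  ∂x-next-last : ∀ h → ∂x k (next h k) ≡ ∂x⁻ h 0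
  ∂x-next-last h = trans (cong (∂x k) (next-last h))
    (cong₂ _-_ (S-periodic 0ℤ (h 0)) (trans (cong (λ z → S z (h 0 - p)) (lem (+ k))) (S-periodic (0ℤ - 1ℤ) (h 0))))
    where
    lem : ∀ a → a ≡ 0ℤ - 1ℤ + (1ℤ + a)
    lem = solve-∀

  -- Summing over a full period, the right differences at the next heights
  -- are a cyclic rearrangement of the left differences.
  ∂x-cyclic : ∀ h → sum qn (λ x → ∂x x (next h x)) ≡ sum qn (∂x⁻ h)
  ∂x-cyclic h = begin
      sum k (λ x → ∂x x (next h x)) + ∂x k (next h k)
    ≡⟨ cong₂ _+_ (sum-cong k (λ x x<k → inner x x<k (∂x-next h x (NP.m<n⇒m<1+n x<k)))) (∂x-next-last h) ⟩
      sum k (λ x → ∂x⁻ h (suc x)) + ∂x⁻ h 0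
    ≡⟨ ZP.+-comm _ (∂x⁻ h 0) ⟩
      ∂x⁻ h 0 + sum k (λ x → ∂x⁻ h (suc x))
    ≡⟨ sym (sum-suc k (∂x⁻ h)) ⟩
      sum qn (∂x⁻ h) ∎
    where
    open ≡-Reasoning
    inner : ∀ x → x ℕ.< k → ∂x x (next h x) ≡ ∂x⁻ h (suc x) ⊎ (x ≡ k) → ∂x x (next h x) ≡ ∂x⁻ h (suc x)
    inner x x<k (inj₁ e) = e
    inner x x<k (inj₂ refl) = ⊥-elim (NP.<-irrefl refl x<k)

  horizontal-raise : ∀ h x → horizontal (raise h 1ℤ) x ≡ horizontal h x + (∂x x (h x) - ∂x x (next h x))
  horizontal-raise h x =
    trans (cong₂ _-_ (prim-step (∂x x) (h x)) (trans (cong (prim (∂x x)) (next-raise h 1ℤ x)) (prim-step (∂x x) (next h x))))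
          (lem (prim (∂x x) (h x)) (prim (∂x x) (next h x)) (∂x x (h x)) (∂x x (next h x)))
    where
    lem : ∀ a b c d → a + c - (b + d) ≡ (a - b) + (c - d)
    lem = solve-∀

  column-Δ : ∀ h x → (vertical (raise h 1ℤ) x - vertical h x) + (∂x x (h x) - ∂x⁻ h x) ≡ Δ S (+ x) (h x)
  column-Δ h x =
    trans (cong (λ z → (S (+ x) (h x + 1ℤ) - S (+ x) z - vertical h x) + (∂x x (h x) - ∂x⁻ h x)) (lem₀ (h x)))
      (trans (lem (S (+ x) (h x + 1ℤ)) (S (+ x) (h x)) (S (+ x) (h x - 1ℤ)) (S (+ suc x) (h x)) (S (+ x - 1ℤ) (h x)))
             (cong (λ z → S z (h x) + S (+ x - 1ℤ) (h x) + S (+ x) (h x + 1ℤ) + S (+ x) (h x - 1ℤ) - + 4 * S (+ x) (h x))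
                   (cong +_ (NP.+-comm 1 x))))
    where
    lem₀ : ∀ a → a + 1ℤ - 1ℤ ≡ a
    lem₀ = solve-∀
    lem : ∀ up c dn rt lf → (up - c - (c - dn)) + ((rt - c) - (c - lf)) ≡ rt + lf + up + dn - + 4 * c
    lem = solve-∀

  flux-raise : ∀ h → flux (raise h 1ℤ) ≡ flux h + sum qn (λ x → Δ S (+ x) (h x))
  flux-raise h = begin
      sum qn (vertical h₁) + sum qn (horizontal h₁)
    ≡⟨ cong (λ z → sum qn (vertical h₁) + z)
            (trans (sum-cong qn (λ x _ → horizontal-raise h x))
                   (trans (sum-+ qn (horizontal h) _) (cong (λ z → sum qn (horizontal h) + z) (sum-- qn _ _)))) ⟩
      sum qn (vertical h₁) + (sum qn (horizontal h) + (sum qn (λ x → ∂x x (h x)) - sum qn (λ x → ∂x x (next h x))))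
    ≡⟨ cong (λ z → sum qn (vertical h₁) + (sum qn (horizontal h) + (sum qn (λ x → ∂x x (h x)) - z))) (∂x-cyclic h) ⟩
      sum qn (vertical h₁) + (sum qn (horizontal h) + (sum qn (λ x → ∂x x (h x)) - sum qn (∂x⁻ h)))
    ≡⟨ lem (sum qn (vertical h₁)) (sum qn (vertical h)) (sum qn (horizontal h)) (sum qn (λ x → ∂x x (h x))) (sum qn (∂x⁻ h)) ⟩
      flux h + ((sum qn (vertical h₁) - sum qn (vertical h)) + (sum qn (λ x → ∂x x (h x)) - sum qn (∂x⁻ h)))
    ≡⟨ cong (λ z → flux h + z) (trans (cong₂ _+_ (sym (sum-- qn _ _)) (sym (sum-- qn _ _)))
                                      (trans (sym (sum-+ qn _ _)) (sum-cong qn (λ x _ → column-Δ h x)))) ⟩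
      flux h + sum qn (λ x → Δ S (+ x) (h x)) ∎
    where
    open ≡-Reasoning
    h₁ : ℕ → ℤ
    h₁ = raise h 1ℤ
    lem : ∀ v₁ v h d e → v₁ + (h + (d - e)) ≡ (v + h) + ((v₁ - v) + (d - e))
    lem = solve-∀

  flux-step : ∀ h j → flux (raise h (+ suc j)) ≡ flux (raise h (+ j)) + sum qn (λ x → Δ S (+ x) (h x + + j))
  flux-step h j = trans (flux-cong _ _ (λ x → sym (lem (h x) (+ j)))) (flux-raise (raise h (+ j)))
    where
    lem : ∀ a j → a + j + 1ℤ ≡ a + (1ℤ + j)
    lem = solve-∀

  Δ-sum≤0 : ∀ (h : ℕ → ℤ) → sum qn (λ x → Δ S (+ x) (h x)) ≤ 0ℤ
  Δ-sum≤0 h = sum-nonpos qn (λ x _ → S-superharmonic (+ x) (h x))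

  flux-antitone : ∀ h j d → flux (raise h (+ (j ℕ.+ d))) ≤ flux (raise h (+ j))
  flux-antitone h j zero = ZP.≤-reflexive (cong (λ z → flux (raise h (+ z))) (NP.+-identityʳ j))
  flux-antitone h j (suc d) = ZP.≤-trans
    (subst (λ z → flux (raise h (+ z)) ≤ flux (raise h (+ (j ℕ.+ d)))) (sym (NP.+-suc j d))
      (subst (_≤ flux (raise h (+ (j ℕ.+ d)))) (sym (flux-step h (j ℕ.+ d)))
        (drop-nonpos (flux (raise h (+ (j ℕ.+ d)))) (Δ-sum≤0 (λ x → h x + + (j ℕ.+ d))))))
    (flux-antitone h j d)

  flux-raise-0 : ∀ h → flux (raise h (+ 0)) ≡ flux h
  flux-raise-0 h = flux-cong _ _ (λ x → ZP.+-identityʳ (h x))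

  flux-constant⇒harmonic : ∀ h J → flux h ≡ flux (raise h (+ J)) →
    ∀ j → j ℕ.< J → ∀ x → x ℕ.< qn → Δ S (+ x) (h x + + j) ≡ 0ℤ
  flux-constant⇒harmonic h J constant j j<J =
    sum-nonpos≡0 qn (λ x → Δ S (+ x) (h x + + j)) (λ x _ → S-superharmonic _ _)
      (ZP.≤-antisym (Δ-sum≤0 (λ x → h x + + j))
                    (ZP.0≤i-j⇒j≤i (subst (0ℤ ≤_) (lem (flux (raise h (+ j))) ΣΔ) (ZP.i≤j⇒0≤j-i chain))))
    where
    ΣΔ : ℤ
    ΣΔ = sum qn (λ x → Δ S (+ x) (h x + + j))
    lem : ∀ a s → (a + s) - a ≡ s - 0ℤ
    lem = solve-∀
    chain : flux (raise h (+ j)) ≤ flux (raise h (+ j)) + sum qn (λ x → Δ S (+ x) (h x + + j))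
    chain = begin
        flux (raise h (+ j))                       ≤⟨ subst (flux (raise h (+ j)) ≤_) (flux-raise-0 h) (flux-antitone h 0 j) ⟩
        flux h                                     ≡⟨ constant ⟩
        flux (raise h (+ J))                       ≡⟨ cong (λ z → flux (raise h (+ z))) (sym (NP.m+[n∸m]≡n j<J)) ⟩
        flux (raise h (+ (suc j ℕ.+ (J ℕ.∸ suc j)))) ≤⟨ flux-antitone h (suc j) (J ℕ.∸ suc j) ⟩
        flux (raise h (+ suc j))                   ≡⟨ flux-step h j ⟩
        flux (raise h (+ j)) + sum qn (λ x → Δ S (+ x) (h x + + j)) ∎
      where open ZP.≤-Reasoning

  steps-sum : ∀ h → sum qn (λ x → h x - next h x) ≡ p
  steps-sum h = begin
      sum qn (λ x → h x - next h x)
    ≡⟨ sum-- qn h (next h) ⟩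
      sum qn h - (sum k (next h) + next h k)
    ≡⟨ cong₂ (λ a b → a - (b + next h k)) (sum-suc k h) (sum-cong k (λ x x<k → next-inner h x x<k)) ⟩
      (h 0 + sum k (λ x → h (suc x))) - (sum k (λ x → h (suc x)) + next h k)
    ≡⟨ cong (λ z → (h 0 + sum k (λ x → h (suc x))) - (sum k (λ x → h (suc x)) + z)) (next-last h) ⟩
      (h 0 + sum k (λ x → h (suc x))) - (sum k (λ x → h (suc x)) + (h 0 - p))
    ≡⟨ lem (h 0) (sum k (λ x → h (suc x))) p ⟩
      p ∎
    where
    open ≡-Reasoning
    lem : ∀ a s p → (a + s) - (s + (a - p)) ≡ p
    lem = solve-∀

  flux-linear : ∀ h a b → (∀ x → x ℕ.< qn → vertical h x ≡ b) →
    (∀ x → x ℕ.< qn → horizontal h x ≡ a * (h x - next h x)) → flux h ≡ + qn * b + a * p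
  flux-linear h a b vert horiz =
    cong₂ _+_ (trans (sum-cong qn vert) (sum-const qn b))
              (trans (sum-cong qn horiz) (trans (sum-scale qn a (λ x → h x - next h x)) (cong (a *_) (steps-sum h))))

zero-spreads : ∀ (U : Fun) → (∀ x y → U x y ≤ 0ℤ) → ∀ x y → U x y ≡ 0ℤ → Δ U x y ≡ 0ℤ →
  (U x (y + 1ℤ) ≡ 0ℤ) × (U x (y - 1ℤ) ≡ 0ℤ)
zero-spreads U U≤0 x y U≡0 harm = proj₂ inner , proj₂ outer
  where
  neighbours : ℤ
  neighbours = U (x + 1ℤ) y + U (x - 1ℤ) y + U x (y + 1ℤ) + U x (y - 1ℤ)
  lem : ∀ s → s - + 4 * 0ℤ ≡ s
  lem = solve-∀
  outer = nonpos-sum≡0 (ZP.+-mono-≤ (ZP.+-mono-≤ (U≤0 _ _) (U≤0 _ _)) (U≤0 _ _)) (U≤0 _ _)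
            (trans (sym (lem neighbours)) (trans (cong (λ z → neighbours - + 4 * z) (sym U≡0)) harm))
  inner = nonpos-sum≡0 (ZP.+-mono-≤ (U≤0 _ _) (U≤0 _ _)) (U≤0 _ _) (proj₁ outer)

zero-down : ∀ (U : Fun) → (∀ x y → U x y ≤ 0ℤ) → ∀ x y k →
  (∀ j → j ℕ.< k → Δ U x (y + + suc j) ≡ 0ℤ) → U x (y + + k) ≡ 0ℤ → U x y ≡ 0ℤ
zero-down U U≤0 x y zero harm top = trans (cong (U x) (sym (ZP.+-identityʳ y))) top
zero-down U U≤0 x y (suc k) harm top = zero-down U U≤0 x y k (λ j j<k → harm j (NP.m<n⇒m<1+n j<k))
  (subst (λ z → U x z ≡ 0ℤ) (lem y (+ k)) (proj₂ (zero-spreads U U≤0 x (y + + suc k) top (harm k NP.≤-refl))))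
  where
  lem : ∀ y k → y + (1ℤ + k) - 1ℤ ≡ y + k
  lem = solve-∀

zero-up : ∀ (U : Fun) → (∀ x y → U x y ≤ 0ℤ) → ∀ x y k →
  (∀ j → j ℕ.< k → Δ U x (y + + j) ≡ 0ℤ) → U x y ≡ 0ℤ → U x (y + + k) ≡ 0ℤ
zero-up U U≤0 x y zero harm bottom = trans (cong (U x) (ZP.+-identityʳ y)) bottom
zero-up U U≤0 x y (suc k) harm bottom =
  subst (λ z → U x z ≡ 0ℤ) (lem y (+ k))
    (proj₁ (zero-spreads U U≤0 x (y + + k) (zero-up U U≤0 x y k (λ j j<k → harm j (NP.m<n⇒m<1+n j<k)) bottom)
                         (harm k NP.≤-refl)))
  where
  lem : ∀ y k → y + k + 1ℤ ≡ y + (1ℤ + k)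
  lem = solve-∀

multiple-in-[0,Q] : ∀ s Q → 0ℤ < Q → 0ℤ ≤ s * Q → s * Q ≤ Q → (s ≡ 0ℤ) ⊎ (s ≡ 1ℤ)
multiple-in-[0,Q] s Q Q>0 lower upper with
  ZP.*-cancelʳ-≤-pos 0ℤ s Q {{Z.positive Q>0}} lower | ZP.*-cancelʳ-≤-pos s 1ℤ Q {{Z.positive Q>0}} (subst (s * Q ≤_) (sym (ZP.*-identityˡ Q)) upper)
... | +≤+ {n = zero} _ | _ = inj₁ refl
... | +≤+ {n = suc zero} _ | _ = inj₂ refl
... | +≤+ {n = suc (suc _)} _ | +≤+ (ℕ.s≤s ())

divides-∣∣⇒multiple : ∀ b k → k ND.∣ ∣ b ∣ → Σ ℤ λ s → b ≡ s * + k
divides-∣∣⇒multiple (+ u) k (ND.divides t e) = + t , trans (cong +_ e) (ZP.pos-* t k)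
divides-∣∣⇒multiple -[1+ u ] k (ND.divides t e) =
  - + t , trans (cong -_ (trans (cong +_ e) (ZP.pos-* t k))) (ZP.neg-distribˡ-* (+ t) (+ k))

-- The cut through A runs at height H in the columns 0, …, q - 2 and at height
-- H - p in the last column; both rows lie strictly inside the rows of A.
baseRow : ℤ → ℤ → ℤ
baseRow m (+ k) = m + 1ℤ + + k
baseRow m -[1+ k ] = m + 1ℤ

Interior : ℤ → ℤ → ℤ → Set
Interior m top y = (m + 1ℤ ≤ y) × (y + 1ℤ ≤ top)

baseRow-interior : ∀ p m r → let top = m + + ∣ p ∣ + + suc (suc r) in
  Interior m top (baseRow m p) × Interior m top (baseRow m p - p)
baseRow-interior (+ k) m r =
  (≤-offset (+ k) (ℕ-nonneg k) refl , ≤-offset (+ r) (ℕ-nonneg r) (lem₁ m (+ k) (+ r))) ,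
  (≤-offset 0ℤ ZP.≤-refl (lem₂ m (+ k)) , ≤-offset (+ k + + r) (+-nonneg (ℕ-nonneg k) (ℕ-nonneg r)) (lem₃ m (+ k) (+ r)))
  where
  lem₁ : ∀ m k r → m + k + (1ℤ + (1ℤ + r)) ≡ m + 1ℤ + k + 1ℤ + r
  lem₁ = solve-∀
  lem₂ : ∀ m k → m + 1ℤ + k - k ≡ m + 1ℤ + 0ℤ
  lem₂ = solve-∀
  lem₃ : ∀ m k r → m + k + (1ℤ + (1ℤ + r)) ≡ m + 1ℤ + k - k + 1ℤ + (k + r)
  lem₃ = solve-∀
baseRow-interior -[1+ k ] m r =
  (≤-offset 0ℤ ZP.≤-refl (sym (ZP.+-identityʳ _)) ,
   ≤-offset (1ℤ + + k + + r) (+-nonneg (ℕ-nonneg (suc k)) (ℕ-nonneg r)) (lem₁ m (+ k) (+ r))) ,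
  (≤-offset (1ℤ + + k) (ℕ-nonneg (suc k)) (lem₂ m (+ k)) , ≤-offset (+ r) (ℕ-nonneg r) (lem₃ m (+ k) (+ r)))
  where
  lem₁ : ∀ m k r → m + (1ℤ + k) + (1ℤ + (1ℤ + r)) ≡ m + 1ℤ + 1ℤ + (1ℤ + k + r)
  lem₁ = solve-∀
  lem₂ : ∀ m k → m + 1ℤ - - (1ℤ + k) ≡ m + 1ℤ + (1ℤ + k)
  lem₂ = solve-∀
  lem₃ : ∀ m k r → m + (1ℤ + k) + (1ℤ + (1ℤ + r)) ≡ m + 1ℤ - - (1ℤ + k) + 1ℤ + r
  lem₃ = solve-∀

module LinearOnA (p : ℤ) (r : ℕ) (n m : ℤ) (S : Fun) (S-min : IsS n (Fpq p (+ suc (suc r))) S)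
  (S≢F : ∀ x y → InA p (+ suc (suc r)) m x y → Fpq p (+ suc (suc r)) x y ≢ S x y)
  (a b c : ℤ) (linear : ∀ x y → InA p (+ suc (suc r)) m x y → S x y ≡ a * x + b * y + c) where

  qn≥1 : 1 ℕ.≤ suc (suc r)
  qn≥1 = ℕ.s≤s ℕ.z≤n

  open Ramp p (suc (suc r))
  open Minimum p (suc (suc r)) qn≥1 n S S-min
  open Cuts p (suc r) S S-periodic S-superharmonic

  top : ℤ
  top = m + + ∣ p ∣ + q

  H : ℤ
  H = baseRow m p

  InRows : ℤ → Set
  InRows y = (m ≤ y) × (y ≤ top)

  InColumns : ℤ → Set
  InColumns x = (0ℤ ≤ x) × (x ≤ q - 1ℤ)

  S-linear : ∀ {x y} → InColumns x → InRows y → S x y ≡ a * x + b * y + c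
  S-linear {x} {y} (c₁ , c₂) (r₁ , r₂) = linear x y (c₁ , c₂ , r₁ , r₂)

  column : ∀ x → x ℕ.< qn → InColumns (+ x)
  column x x<q = ℕ-nonneg x , ≤-offset _ (ZP.i≤j⇒0≤j-i (+≤+ x<q)) (lem (+ x) q)
    where
    lem : ∀ x q → q - 1ℤ ≡ x + (q - (1ℤ + x))
    lem = solve-∀

  interior-row : ∀ {y} → Interior m top y → InRows y
  interior-row {y} (m<y , y<top) = ZP.≤-trans (ZP.i≤i+j m 1ℤ) m<y , ZP.≤-trans (ZP.i≤i+j y 1ℤ) y<top

  interior-above : ∀ {y} → Interior m top y → InRows (y + 1ℤ)
  interior-above {y} int = ZP.≤-trans (proj₁ (interior-row int)) (ZP.i≤i+j y 1ℤ) , proj₂ int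

  interior-below : ∀ {y} → Interior m top y → InRows (y - 1ℤ)
  interior-below {y} int =
    ≤-offset _ (ZP.i≤j⇒0≤j-i (proj₁ int)) (lem m y) , ZP.≤-trans (ZP.i-j≤i y 1ℤ) (proj₂ (interior-row int))
    where
    lem : ∀ m y → y - 1ℤ ≡ m + (y - (m + 1ℤ))
    lem = solve-∀

  H-interior : Interior m top H
  H-interior = proj₁ (baseRow-interior p m r)

  H-p-interior : Interior m top (H - p)
  H-p-interior = proj₂ (baseRow-interior p m r)

  -- The linear form is superharmonic across the period only if a q = b p:
  -- the Laplacians at (0,H) and at (q-1,H-p) are aq - bp and bp - aq.
  ΔS-first : Δ S 0ℤ H ≡ a * q - b * p
  ΔS-first = trans (stencil-cong (S-linear (column 1 (ℕ.s≤s (ℕ.s≤s ℕ.z≤n))) (interior-row H-interior))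
                                 (trans (sym (S-periodic (0ℤ - 1ℤ) H)) (S-linear (column (suc r) NP.≤-refl) (interior-row H-p-interior)))
                                 (S-linear (column 0 qn≥1) (interior-above H-interior))
                                 (S-linear (column 0 qn≥1) (interior-below H-interior))
                                 (S-linear (column 0 qn≥1) (interior-row H-interior)))
                   (lem a b c p (+ r) H)
    where
    lem : ∀ a b c p r H → (a * (0ℤ + 1ℤ) + b * H + c) + (a * (0ℤ - 1ℤ + (1ℤ + (1ℤ + r))) + b * (H + - p) + c)
      + (a * 0ℤ + b * (H + 1ℤ) + c) + (a * 0ℤ + b * (H - 1ℤ) + c) - + 4 * (a * 0ℤ + b * H + c)
      ≡ a * (1ℤ + (1ℤ + r)) - b * p
    lem = solve-∀

  ΔS-last : Δ S (+ suc r) (H - p) ≡ b * p - a * q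
  ΔS-last = trans (stencil-cong (trans (cong (λ z → S z (H - p)) (lem₀ (+ r))) (trans (S-periodic 0ℤ H)
                                   (S-linear (column 0 qn≥1) (interior-row H-interior))))
                                (S-linear (column r (NP.m<n⇒m<1+n NP.≤-refl)) (interior-row H-p-interior))
                                (S-linear (column (suc r) NP.≤-refl) (interior-above H-p-interior))
                                (S-linear (column (suc r) NP.≤-refl) (interior-below H-p-interior))
                                (S-linear (column (suc r) NP.≤-refl) (interior-row H-p-interior)))
                  (lem a b c p (+ r) H)
    where
    lem₀ : ∀ r → 1ℤ + r + 1ℤ ≡ 0ℤ + (1ℤ + (1ℤ + r))
    lem₀ = solve-∀
    lem : ∀ a b c p r H → (a * 0ℤ + b * H + c) + (a * (1ℤ + r - 1ℤ) + b * (H - p) + c)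
      + (a * (1ℤ + r) + b * (H - p + 1ℤ) + c) + (a * (1ℤ + r) + b * (H - p - 1ℤ) + c) - + 4 * (a * (1ℤ + r) + b * (H - p) + c)
      ≡ b * p - a * (1ℤ + (1ℤ + r))
    lem = solve-∀

  aq≡bp : a * q ≡ b * p
  aq≡bp = ZP.≤-antisym (nonpos-difference (a * q) (b * p) (subst (_≤ 0ℤ) ΔS-first (S-superharmonic 0ℤ H)))
                       (nonpos-difference (b * p) (a * q) (subst (_≤ 0ℤ) ΔS-last (S-superharmonic _ _)))
    where
    nonpos-difference : ∀ u v → u - v ≤ 0ℤ → u ≤ v
    nonpos-difference u v h = ZP.0≤i-j⇒j≤i (subst (0ℤ ≤_) (lem u v) (ZP.neg-mono-≤ h))
      where
      lem : ∀ u v → - (u - v) ≡ v - u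
      lem = solve-∀

  cutA : ℕ → ℤ
  cutA x with x ℕ.≟ suc r
  ... | yes _ = H - p
  ... | no _ = H

  cutA-interior : ∀ x → Interior m top (cutA x)
  cutA-interior x with x ℕ.≟ suc r
  ... | yes _ = H-p-interior
  ... | no _ = H-interior

  cutA-0 : cutA 0 ≡ H
  cutA-0 with 0 ℕ.≟ suc r
  ... | yes ()
  ... | no _ = refl

  cutA-last : cutA (suc r) ≡ H - p
  cutA-last with suc r ℕ.≟ suc r
  ... | no ne = ⊥-elim (ne refl)
  ... | yes _ = refl

  next-cutA-last : next cutA (suc r) ≡ cutA (suc r)
  next-cutA-last = trans (next-last cutA) (trans (cong (_- p) cutA-0) (sym cutA-last))

  next-cutA-interior : ∀ x → x ℕ.< qn → Interior m top (next cutA x)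
  next-cutA-interior x x<q = by-position (NP.m≤n⇒m<n∨m≡n (NP.≤-pred x<q))
    where
    by-position : (x ℕ.< suc r) ⊎ (x ≡ suc r) → Interior m top (next cutA x)
    by-position (inj₁ x<last) = subst (Interior m top) (sym (next-inner cutA x x<last)) (cutA-interior (suc x))
    by-position (inj₂ x≡last) =
      subst (Interior m top) (sym (trans (cong (next cutA) x≡last) next-cutA-last)) (cutA-interior (suc r))

  vertical-cutA : ∀ x → x ℕ.< qn → vertical cutA x ≡ b
  vertical-cutA x x<q =
    trans (cong₂ _-_ (S-linear (column x x<q) (interior-row (cutA-interior x)))
                     (S-linear (column x x<q) (interior-below (cutA-interior x))))
          (lem a b c (+ x) (cutA x))
    where
    lem : ∀ a b c x h → (a * x + b * h + c) - (a * x + b * (h - 1ℤ) + c) ≡ b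
    lem = solve-∀

  ∂x-on-A : ∀ x → suc x ℕ.< qn → ∀ y → m ≤ y → y ≤ top → ∂x x y ≡ a
  ∂x-on-A x x+1<q y m≤y y≤top =
    trans (cong₂ _-_ (S-linear (column (suc x) x+1<q) (m≤y , y≤top))
                     (S-linear (column x (NP.<-trans (NP.n<1+n x) x+1<q)) (m≤y , y≤top)))
          (lem a b c (+ x) y)
    where
    lem : ∀ a b c x y → (a * (1ℤ + x) + b * y + c) - (a * x + b * y + c) ≡ a
    lem = solve-∀

  horizontal-cutA-last : horizontal cutA (suc r) ≡ a * (cutA (suc r) - next cutA (suc r))
  horizontal-cutA-last = begin
      prim (∂x (suc r)) (cutA (suc r)) - prim (∂x (suc r)) (next cutA (suc r))
    ≡⟨ cong (λ z → prim (∂x (suc r)) (cutA (suc r)) - prim (∂x (suc r)) z) next-cutA-last ⟩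
      prim (∂x (suc r)) (cutA (suc r)) - prim (∂x (suc r)) (cutA (suc r))
    ≡⟨ ZP.+-inverseʳ (prim (∂x (suc r)) (cutA (suc r))) ⟩
      0ℤ
    ≡⟨ lem a (cutA (suc r)) ⟩
      a * (cutA (suc r) - cutA (suc r))
    ≡⟨ cong (λ z → a * (cutA (suc r) - z)) (sym next-cutA-last) ⟩
      a * (cutA (suc r) - next cutA (suc r)) ∎
    where
    open ≡-Reasoning
    lem : ∀ a u → 0ℤ ≡ a * (u - u)
    lem = solve-∀

  horizontal-cutA : ∀ x → x ℕ.< qn → horizontal cutA x ≡ a * (cutA x - next cutA x)
  horizontal-cutA x x<q = by-position (x ℕ.≟ suc r)
    where
    by-position : Dec (x ≡ suc r) → horizontal cutA x ≡ a * (cutA x - next cutA x)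
    by-position (yes x≡last) =
      subst (λ z → horizontal cutA z ≡ a * (cutA z - next cutA z)) (sym x≡last) horizontal-cutA-last
    by-position (no x≢last) = prim-const (∂x x) a (cutA x) (next cutA x) m top
      (proj₁ (interior-row (cutA-interior x))) (proj₁ (interior-row (next-cutA-interior x x<q)))
      (proj₂ (interior-row (cutA-interior x))) (proj₂ (interior-row (next-cutA-interior x x<q)))
      (∂x-on-A x (ℕ.s≤s (NP.≤∧≢⇒< (NP.≤-pred x<q) x≢last)))

  flux-cutA : flux cutA ≡ q * b + a * p
  flux-cutA = flux-linear cutA a b vertical-cutA horizontal-cutA

  -- Cuts far above and far below A.  Beyond the rows ±Yup the strip of
  -- columns 0 … q lies where |N| ≥ R, so S is 0 above and N below.
  Yup : ℤ
  Yup = R + + ∣ p ∣ * q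

  Yup≥0 : 0ℤ ≤ Yup
  Yup≥0 = +-nonneg R≥0 (*-nonneg (ℕ-nonneg ∣ p ∣) (ℕ-nonneg qn))

  q-1≥0 : 0ℤ ≤ q - 1ℤ
  q-1≥0 = ≤-offset (+ suc r) (ℕ-nonneg (suc r)) (lem (+ r))
    where
    lem : ∀ r → 1ℤ + (1ℤ + r) - 1ℤ ≡ 0ℤ + (1ℤ + r)
    lem = solve-∀

  N-above : ∀ X Y → 0ℤ ≤ X → X ≤ q → Yup ≤ Y → R ≤ N X Y
  N-above X Y 0≤X X≤q Yup≤Y =
    ≤-offset _ (+-nonneg (+-nonneg (+-nonneg (*-nonneg (subst (0ℤ ≤_) (ZP.+-comm (+ ∣ p ∣) p) ∣p∣+p≥0) 0≤X)
                                             (*-nonneg (ℕ-nonneg ∣ p ∣) (ZP.i≤j⇒0≤j-i X≤q)))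
                                   (*-nonneg q-1≥0 (ZP.≤-trans Yup≥0 Yup≤Y)))
                         (ZP.i≤j⇒0≤j-i Yup≤Y))
               (lem p q X Y R (+ ∣ p ∣))
    where
    lem : ∀ p q X Y T a → p * X + q * Y ≡ T + ((((p + a) * X) + (a * (q - X))) + ((q - 1ℤ) * Y) + (Y - (T + a * q)))
    lem = solve-∀

  N-below : ∀ X Y → 0ℤ ≤ X → X ≤ q → Y ≤ - Yup → N X Y ≤ - R
  N-below X Y 0≤X X≤q Y≤-Yup =
    ≤-offset _ (+-nonneg (+-nonneg (+-nonneg (*-nonneg ∣p∣-p≥0 0≤X) (*-nonneg (ℕ-nonneg ∣ p ∣) (ZP.i≤j⇒0≤j-i X≤q)))
                                   (*-nonneg q-1≥0 (ZP.neg-mono-≤ (ZP.≤-trans Y≤-Yup (ZP.neg-mono-≤ Yup≥0)))))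
                         (ZP.i≤j⇒0≤j-i Y≤-Yup))
               (lem p q X Y R (+ ∣ p ∣))
    where
    lem : ∀ p q X Y T a → - T ≡ p * X + q * Y + ((((a - p) * X) + (a * (q - X))) + ((q - 1ℤ) * (- Y)) + (- (T + a * q) - Y))
    lem = solve-∀

  S≡0-high : ∀ x y → x ℕ.≤ qn → Yup ≤ y → S (+ x) y ≡ 0ℤ
  S≡0-high x y x≤q Yup≤y = S≡0-above (+ x) y (N-above (+ x) y (ℕ-nonneg x) (+≤+ x≤q) Yup≤y)

  S≡N-low : ∀ x y → x ℕ.≤ qn → y ≤ - Yup → S (+ x) y ≡ N (+ x) y
  S≡N-low x y x≤q y≤-Yup = S≡N-below (+ x) y (N-below (+ x) y (ℕ-nonneg x) (+≤+ x≤q) y≤-Yup)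

  Jup : ℕ
  Jup = suc ∣ Yup - m ∣

  high-rows : ∀ y → m + 1ℤ ≤ y → Yup ≤ y + + Jup - 1ℤ
  high-rows y m<y =
    ≤-offset _ (+-nonneg (+-nonneg (ZP.i≤j⇒0≤j-i m<y) (ZP.i≤j⇒0≤j-i (j≤i+∣j-i∣ m Yup))) (ℕ-nonneg 1))
               (lem y m Yup (+ ∣ Yup - m ∣))
    where
    lem : ∀ y m Y a → y + (1ℤ + a) - 1ℤ ≡ Y + ((y - (m + 1ℤ)) + ((m + a) - Y) + 1ℤ)
    lem = solve-∀

  high-rows' : ∀ y → m + 1ℤ ≤ y → Yup ≤ y + + Jup
  high-rows' y m<y = ZP.≤-trans (high-rows y m<y) (ZP.i-j≤i (y + + Jup) 1ℤ)

  high-top : ∀ y → y + 1ℤ ≤ top → y + + Jup ≤ top + + Jup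
  high-top y y<top = ZP.+-monoˡ-≤ (+ Jup) (ZP.≤-trans (ZP.i≤i+j y 1ℤ) y<top)

  flux-high : flux (raise cutA (+ Jup)) ≡ 0ℤ
  flux-high = trans (flux-linear (raise cutA (+ Jup)) 0ℤ 0ℤ vert horiz) (lem q p)
    where
    lem : ∀ q p → q * 0ℤ + 0ℤ * p ≡ 0ℤ
    lem = solve-∀
    vert : ∀ x → x ℕ.< qn → vertical (raise cutA (+ Jup)) x ≡ 0ℤ
    vert x x<q = cong₂ _-_ (S≡0-high x _ (NP.<⇒≤ x<q) (high-rows' (cutA x) (proj₁ (cutA-interior x))))
                           (S≡0-high x _ (NP.<⇒≤ x<q) (high-rows (cutA x) (proj₁ (cutA-interior x))))
    horiz : ∀ x → x ℕ.< qn → horizontal (raise cutA (+ Jup)) x ≡ 0ℤ * (cutA x + + Jup - next (raise cutA (+ Jup)) x)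
    horiz x x<q = prim-const (∂x x) 0ℤ _ _ Yup (top + + Jup)
      (high-rows' (cutA x) (proj₁ (cutA-interior x)))
      (subst (Yup ≤_) (sym (next-raise cutA (+ Jup) x)) (high-rows' (next cutA x) (proj₁ (next-cutA-interior x x<q))))
      (high-top (cutA x) (proj₂ (cutA-interior x)))
      (subst (_≤ top + + Jup) (sym (next-raise cutA (+ Jup) x)) (high-top (next cutA x) (proj₂ (next-cutA-interior x x<q))))
      (λ y Yup≤y _ → cong₂ _-_ (S≡0-high (suc x) y x<q Yup≤y) (S≡0-high x y (NP.<⇒≤ x<q) Yup≤y))

  Jdn : ℕ
  Jdn = suc ∣ top - (- Yup) ∣

  cutB : ℕ → ℤ
  cutB = raise cutA (- + Jdn)

  low-rows : ∀ y → y + 1ℤ ≤ top → y - + Jdn ≤ - Yup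
  low-rows y y<top =
    ≤-offset _ (+-nonneg (+-nonneg (ZP.i≤j⇒0≤j-i y<top) (ZP.i≤j⇒0≤j-i (j≤i+∣j-i∣ (- Yup) top))) (ℕ-nonneg 2))
               (lem y top Yup (+ ∣ top - (- Yup) ∣))
    where
    lem : ∀ y t Y a → - Y ≡ y - (1ℤ + a) + ((t - (y + 1ℤ)) + ((- Y + a) - t) + + 2)
    lem = solve-∀

  low-rows' : ∀ y → y + 1ℤ ≤ top → y - + Jdn - 1ℤ ≤ - Yup
  low-rows' y y<top = ZP.≤-trans (ZP.i-j≤i (y - + Jdn) 1ℤ) (low-rows y y<top)

  low-bottom : ∀ y → m + 1ℤ ≤ y → m - + Jdn ≤ y - + Jdn
  low-bottom y m<y = ZP.+-monoˡ-≤ (- + Jdn) (ZP.≤-trans (ZP.i≤i+j m 1ℤ) m<y)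

  Q : ℤ
  Q = q * q + p * p

  flux-low : flux cutB ≡ Q
  flux-low = flux-linear cutB p q vert horiz
    where
    vert : ∀ x → x ℕ.< qn → vertical cutB x ≡ q
    vert x x<q = trans (cong₂ _-_ (S≡N-low x _ (NP.<⇒≤ x<q) (low-rows (cutA x) (proj₂ (cutA-interior x))))
                                  (S≡N-low x _ (NP.<⇒≤ x<q) (low-rows' (cutA x) (proj₂ (cutA-interior x)))))
                       (lem p q (+ x) (cutB x))
      where
      lem : ∀ p q x y → (p * x + q * y) - (p * x + q * (y - 1ℤ)) ≡ q
      lem = solve-∀
    horiz : ∀ x → x ℕ.< qn → horizontal cutB x ≡ p * (cutB x - next cutB x)
    horiz x x<q = prim-const (∂x x) p (cutB x) (next cutB x) (m - + Jdn) (- Yup)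
      (low-bottom (cutA x) (proj₁ (cutA-interior x)))
      (subst (m - + Jdn ≤_) (sym (next-raise cutA (- + Jdn) x)) (low-bottom (next cutA x) (proj₁ (next-cutA-interior x x<q))))
      (low-rows (cutA x) (proj₂ (cutA-interior x)))
      (subst (_≤ - Yup) (sym (next-raise cutA (- + Jdn) x)) (low-rows (next cutA x) (proj₂ (next-cutA-interior x x<q))))
      (λ y _ y≤-Yup → trans (cong₂ _-_ (S≡N-low (suc x) y x<q y≤-Yup) (S≡N-low x y (NP.<⇒≤ x<q) y≤-Yup)) (lem p q (+ x) y))
      where
      lem : ∀ p q x y → (p * (1ℤ + x) + q * y) - (p * x + q * y) ≡ p
      lem = solve-∀

  cutB-raised : flux (raise cutB (+ Jdn)) ≡ flux cutA
  cutB-raised = flux-cong _ _ (λ x → lem (cutA x) (+ Jdn))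
    where
    lem : ∀ h j → h - j + j ≡ h
    lem = solve-∀

  -- Monotonicity of the flux squeezes the flux through A into [0, Q].
  flux-cutA-bounds : (0ℤ ≤ flux cutA) × (flux cutA ≤ Q)
  flux-cutA-bounds =
    subst₂ _≤_ flux-high (flux-raise-0 cutA) (flux-antitone cutA 0 Jup) ,
    subst₂ _≤_ cutB-raised (trans (flux-raise-0 cutB) flux-low) (flux-antitone cutB 0 Jdn)

  F≤S⇒F≡S : ∀ x y → F x y ≤ S x y → F x y ≡ S x y
  F≤S⇒F≡S x y F≤S = ZP.≤-antisym F≤S (S≤F x y)

  H∈A : InA p q m 0ℤ H
  H∈A = proj₁ (column 0 qn≥1) , proj₂ (column 0 qn≥1) , interior-row H-interior

  -- Flux 0 through A: the flux is then constant on the way up to the cut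
  -- far above, S is harmonic along column 0 above H, and the zeros of S far
  -- above spread down to (0,H), where then S = F = 0.
  flux-cutA≢0 : flux cutA ≢ 0ℤ
  flux-cutA≢0 flux≡0 = S≢F 0ℤ H H∈A (F≤S⇒F≡S 0ℤ H (subst (F 0ℤ H ≤_) (sym S≡0) (F≤0 0ℤ H)))
    where
    harmonic : ∀ j → j ℕ.< Jup → Δ S 0ℤ (H + + j) ≡ 0ℤ
    harmonic j j<J = subst (λ z → Δ S 0ℤ (z + + j) ≡ 0ℤ) cutA-0
      (flux-constant⇒harmonic cutA Jup (trans flux≡0 (sym flux-high)) j j<J 0 qn≥1)
    lem : ∀ y k → y + (1ℤ + k) - 1ℤ ≡ y + k
    lem = solve-∀
    S≡0-far : S 0ℤ (H + + ∣ Yup - m ∣) ≡ 0ℤ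
    S≡0-far = S≡0-high 0 _ ℕ.z≤n (subst (Yup ≤_) (lem H (+ ∣ Yup - m ∣)) (high-rows H (proj₁ H-interior)))
    S≡0 : S 0ℤ H ≡ 0ℤ
    S≡0 = zero-down S S≤0 0ℤ H ∣ Yup - m ∣ (λ j j<k → harmonic (suc j) (ℕ.s≤s j<k)) S≡0-far

  T : Fun
  T x y = S x y - N x y

  T≤0 : ∀ x y → T x y ≤ 0ℤ
  T≤0 x y = ZP.i≤j⇒i-j≤0 (ZP.≤-trans (S≤F x y) (F≤N x y))

  ΔT≡ΔS : ∀ x y → Δ T x y ≡ Δ S x y
  ΔT≡ΔS x y = lem (S (x + 1ℤ) y) (S (x - 1ℤ) y) (S x (y + 1ℤ)) (S x (y - 1ℤ)) (S x y) p q x y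
    where
    lem : ∀ s₁ s₂ s₃ s₄ s₅ p q x y →
      ((s₁ - (p * (x + 1ℤ) + q * y)) + (s₂ - (p * (x - 1ℤ) + q * y)) + (s₃ - (p * x + q * (y + 1ℤ)))
        + (s₄ - (p * x + q * (y - 1ℤ)))) - + 4 * (s₅ - (p * x + q * y))
      ≡ (s₁ + s₂ + s₃ + s₄) - + 4 * s₅
    lem = solve-∀

  -- Flux Q through A: the flux is then constant from the cut far below up to
  -- A, S is harmonic along column 0 below H, and the zeros of T far below
  -- spread up to (0,H), where then S = N ≥ F.
  flux-cutA≢Q : flux cutA ≢ Q
  flux-cutA≢Q flux≡Q = S≢F 0ℤ H H∈A (F≤S⇒F≡S 0ℤ H (subst (F 0ℤ H ≤_) (sym S≡N) (F≤N 0ℤ H)))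
    where
    harmonic : ∀ j → j ℕ.< Jdn → Δ T 0ℤ (H - + Jdn + + j) ≡ 0ℤ
    harmonic j j<J = trans (ΔT≡ΔS _ _) (subst (λ z → Δ S 0ℤ (z - + Jdn + + j) ≡ 0ℤ) cutA-0
      (flux-constant⇒harmonic cutB Jdn (trans flux-low (trans (sym flux≡Q) (sym cutB-raised))) j j<J 0 qn≥1))
    T≡0-far : T 0ℤ (H - + Jdn) ≡ 0ℤ
    T≡0-far = trans (cong (_- N 0ℤ (H - + Jdn)) (S≡N-low 0 _ ℕ.z≤n (low-rows H (proj₂ H-interior))))
                    (ZP.+-inverseʳ (N 0ℤ (H - + Jdn)))
    lem : ∀ h j → h - j + j ≡ h
    lem = solve-∀
    T≡0 : T 0ℤ H ≡ 0ℤ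
    T≡0 = subst (λ z → T 0ℤ z ≡ 0ℤ) (lem H (+ Jdn)) (zero-up T T≤0 0ℤ (H - + Jdn) Jdn harmonic T≡0-far)
    lem₂ : ∀ s n → s ≡ n + (s - n)
    lem₂ = solve-∀
    S≡N : S 0ℤ H ≡ N 0ℤ H
    S≡N = trans (lem₂ (S 0ℤ H) (N 0ℤ H)) (trans (cong (λ z → N 0ℤ H + z) T≡0) (ZP.+-identityʳ _))

  Q>0 : 0ℤ < Q
  Q>0 = ZP.<-≤-trans (+<+ (ℕ.s≤s ℕ.z≤n))
          (subst (_≤ Q) (ZP.+-identityʳ (q * q)) (ZP.+-monoʳ-≤ (q * q) (subst (0ℤ ≤_) (sym (i*i≡∣i∣² p)) (ℕ-nonneg _))))

  -- With b = s q, the relation a q = b p gives a = s p, so the flux through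
  -- A is s Q.
  flux-multiple : ∀ s → b ≡ s * q → flux cutA ≡ s * Q
  flux-multiple s b≡sq = trans flux-cutA (trans (cong₂ (λ u v → q * u + v * p) b≡sq a≡sp) (lem s q p))
    where
    lem : ∀ s q p → q * (s * q) + s * p * p ≡ s * (q * q + p * p)
    lem = solve-∀
    lem₂ : ∀ s q p → s * q * p ≡ s * p * q
    lem₂ = solve-∀
    a≡sp : a ≡ s * p
    a≡sp = ZP.*-cancelʳ-≡ a (s * p) q (trans aq≡bp (trans (cong (_* p) b≡sq) (lem₂ s q p)))

  -- For coprime p and q, a q = b p forces q ∣ b; the flux s Q through A then
  -- has s ∈ {0,1} by the bounds, and both values were excluded.
  coprime-impossible : NC.Coprime qn ∣ p ∣ → ⊥
  coprime-impossible coprime =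
    excluded (multiple-in-[0,Q] s Q Q>0 (subst (0ℤ ≤_) flux≡sQ (proj₁ flux-cutA-bounds))
                                        (subst (_≤ Q) flux≡sQ (proj₂ flux-cutA-bounds)))
    where
    ∣aq∣≡∣bp∣ : ∣ a ∣ ℕ.* qn ≡ ∣ b ∣ ℕ.* ∣ p ∣
    ∣aq∣≡∣bp∣ = trans (sym (ZP.∣i*j∣≡∣i∣*∣j∣ a q)) (trans (cong ∣_∣ aq≡bp) (ZP.∣i*j∣≡∣i∣*∣j∣ b p))
    q∣b : qn ND.∣ ∣ b ∣
    q∣b = NC.coprime-divisor coprime (ND.divides ∣ a ∣ (trans (NP.*-comm ∣ p ∣ ∣ b ∣) (sym ∣aq∣≡∣bp∣)))
    b-multiple : Σ ℤ λ s → b ≡ s * q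
    b-multiple = divides-∣∣⇒multiple b qn q∣b
    s : ℤ
    s = proj₁ b-multiple
    flux≡sQ : flux cutA ≡ s * Q
    flux≡sQ = flux-multiple s (proj₂ b-multiple)
    excluded : (s ≡ 0ℤ) ⊎ (s ≡ 1ℤ) → ⊥
    excluded (inj₁ s≡0) = flux-cutA≢0 (trans flux≡sQ (trans (cong (_* Q) s≡0) (ZP.*-zeroˡ Q)))
    excluded (inj₂ s≡1) = flux-cutA≢Q (trans flux≡sQ (trans (cong (_* Q) s≡1) (ZP.*-identityˡ Q)))

gcd≯1⇒coprime : ∀ p qn → ¬ (1ℤ < gcd p (+ suc qn)) → NC.Coprime (suc qn) ∣ p ∣
gcd≯1⇒coprime p qn gcd≯1 = NC.sym (NC.gcd≡1⇒coprime (NP.≤-antisym gcd≤1 gcd≥1))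
  where
  gcd≤1 : NG.gcd ∣ p ∣ (suc qn) ℕ.≤ 1
  gcd≤1 = ZP.drop‿+≤+ (ZP.≮⇒≥ gcd≯1)
  gcd≥1 : 1 ℕ.≤ NG.gcd ∣ p ∣ (suc qn)
  gcd≥1 with NG.gcd ∣ p ∣ (suc qn) in eq
  ... | zero = case NG.gcd[m,n]≡0⇒n≡0 ∣ p ∣ eq of λ ()
  ... | suc _ = ℕ.s≤s ℕ.z≤n

lemma7p4 : (p q : ℤ) → q > 1ℤ → (n : ℤ) → n > 0ℤ → (m : ℤ) →
    (S : Fun) → IsS n (Fpq p q) S →
    (∀ x y → InA p q m x y → Fpq p q x y ≢ S x y) →
    (Σ ℤ λ a → Σ ℤ λ b → Σ ℤ λ c →
    ∀ x y → InA p q m x y → S x y ≡ a * x + b * y + c) →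
    gcd p q > 1ℤ
lemma7p4 p (+ zero) (+<+ ()) n _ m S S-min S≢F linear
lemma7p4 p (+ suc zero) (+<+ (ℕ.s≤s ())) n _ m S S-min S≢F linear
lemma7p4 p (+ suc (suc r)) _ n _ m S S-min S≢F (a , b , c , linear) =
  decidable-stable (1ℤ ZP.<? gcd p (+ suc (suc r))) (λ gcd≯1 →
    LinearOnA.coprime-impossible p r n m S S-min S≢F a b c linear (gcd≯1⇒coprime p (suc r) gcd≯1))
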